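{- Let $(G,w)$ be a vertex-weighted graph and let $f$ be an expression for which $Var(f)$ is defined, with a fixed total ordering $<$ on $Var(f)$. Then $$ XB_{(G,w)}[f] = \sum_{(\gamma, \kappa)} (1+t)^{|B(\gamma)|}(-1)^{c(N(G,\gamma,\kappa))}\left(\prod_{v \in V(G)} \kappa(v)^{w(v)}\right), $$ where the sum runs over all acyclic biorientations $\gamma$ of $G$ and maps $\kappa: V(G) \rightarrow Var(f)$ such that for each edge $uv \in E(G)$: if $\kappa(u) < \kappa(v)$, then $uv$ is singly directed from $u$ to $v$; if $\kappa(u) = \kappa(v)$ has positive sign, then $uv$ is bidirected; if $\kappa(u) = \kappa(v)$ has negative sign, then $uv$ may be oriented in any of the three possible ways. (After summing, primed variables are replaced by their unprimed versions.)
   Context: A vertex-weighted graph $(G,w)$ is a finite graph $G$ (loops and multi-edges allowed) with $w:V(G)\to\mathbb{Z}^+$. The Tutte symmetric function is $XB_{(G,w)}=\sum_{\kappa}(1+t)^{e(\kappa)}\prod_{v}x_{\kappa(v)}^{w(v)}$ over all colourings $\kappa:V(G)\to\mathbb{Z}^+$, where $e(\kappa)$ is the number of edges whose endpoints get equal colours; coefficients lie in $\mathbb{C}[t]$, and plethysm acts on the $x$-variables with $t$ treated as a constant. A biorientation assigns to each edge either a single direction or both directions (a bidirected edge); $B(\gamma)$ is the set of bidirected edges. A biorientation is acyclic if it has no directed cycle using at least one singly directed edge. $N(G,\gamma,\kappa)$ is the graph with vertex set $V^-(G)$, the vertices $v$ with $\operatorname{sgn}(\kappa(v))=-1$, and edge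 set the bidirected edges of $\gamma$ with both endpoints in $V^-(G)$; $c(\cdot)$ is the number of connected components. Plethysm: $c[f]=c$; $p_n[c]=c$; $p_n[p_m]=p_{nm}$; $p_n[f+g]=p_n[f]+p_n[g]$; $p_n[fg]=p_n[f]p_n[g]$; $(fg)[h]=f[h]g[h]$; $(f+g)[h]=f[h]+g[h]$; $p_n[q]=q^n$; $\mathbf{x}=x_1+x_2+\cdots$, $\mathbf{x}_n=x_1+\cdots+x_n$; $p_n[\epsilon g]=(-1)^np_n[g]$. Variable sets: each variable $z$ has a formal sign $\operatorname{sgn}(z)\in\{\pm1\}$, base variables positive. $Var(1)=\{1\}$; $Var(q)=\{q\}$; $Var(\mathbf{x}_n)=\{x_1,\dots,x_n\}$; $Var(\mathbf{x})=\{x_1,x_2,\dots\}$; $Var(f+g)=Var(f)\cup Var(g)\cup(Var(f)\cap Var(g))'$ where $z'$ is a formally distinct duplicate of $z$ (same value and sign) later replaced by $z$; $Var(-f)=\{\overline z\}$ where $\overline z$ has the same value as $z$ and opposite sign; $Var(\epsilon f)=\{ -z\}$ (value negated, sign unchanged); $Var(fg)=\{zw\}$ with $\operatorname{sgn}(zw)=\operatorname{sgn}(z)\operatorname{sgn}(w)$. $\kappa(v)^{w(v)}$ is the value of $\kappa(v)$ raised to $w(v)$. -}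

module Defs where

open import Level using (Level; _⊔_)
open import Function using (_∘_)
open import Data.Nat as ℕ using (ℕ; zero; suc; _<ᵇ_)
open import Data.Fin as Fin using (Fin; toℕ)
open import Data.Fin.Properties using () renaming (_≟_ to _≟F_)
open import Data.Bool using (Bool; true; false; _∧_; _∨_; not; if_then_else_)
open import Data.List using (List; []; _∷_; map; foldr; concatMap; allFin; length; filterᵇ)
open import Data.Product using (_×_; _,_)
open import Data.Sum using (_⊎_; inj₁; inj₂)
open import Data.Unit using (⊤; tt)
open import Relation.Nullary.Decidable using (⌊_⌋)
open import Relation.Binary.Core using (Rel)
open import Relation.Binary.Definitions using (Tri; tri<; tri≈; tri>; Trichotomous)
open import Relation.Binary.PropositionalEquality using (_≡_)
open import Relation.Binary.Structures using (IsStrictTotalOrder)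
open import Algebra.Bundles using (CommutativeRing)

-- Finite multigraphs (loops and multi-edges allowed).  A vertex weight
-- is a function  Fin nV → ℕ  (positivity is a hypothesis of the theorem).

record Graph : Set where
  field
    nV   : ℕ
    nE   : ℕ
    ends : Fin nE → Fin nV × Fin nV

-- Expressions f for which Var(f) is defined:
--   𝟙 = 1,  q j = the formal variable q (an indexed family q_j),
--   𝐱ₙ n = x_1+…+x_n,  𝐱 = x_1+x_2+…,  f ⊕ g = f+g,  ⊖ f = -f,
--   ε f = ε f,  f ⊗ g = fg.

data Expr : Set where
  𝟙   : Expr
  q   : ℕ → Expr
  𝐱ₙ  : ℕ → Expr
  𝐱   : Expr
  _⊕_ : Expr → Expr → Expr
  ⊖_  : Expr → Expr
  ε_  : Expr → Expr
  _⊗_ : Expr → Expr → Expr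

-- Var(f), with 𝐱 truncated to x_1,…,x_N (all x_i with i > N set to 0).
-- Var(f+g) is the disjoint union (the primed duplicates of common
-- variables are the right-hand copies); Var(fg) is the set of all
-- products zw, indexed by pairs (z , w).
Var : ℕ → Expr → Set
Var N 𝟙        = ⊤
Var N (q j)    = ⊤
Var N (𝐱ₙ n)   = Fin n
Var N 𝐱        = Fin N
Var N (f ⊕ g)  = Var N f ⊎ Var N g
Var N (⊖ f)    = Var N f
Var N (ε f)    = Var N f
Var N (f ⊗ g)  = Var N f × Var N g

-- formal sign: true = +1, false = -1
sgn : ∀ {N} (f : Expr) → Var N f → Bool
sgn 𝟙 _              = true
sgn (q j) _          = true
sgn (𝐱ₙ n) _         = true
sgn 𝐱 _              = true
sgn (f ⊕ g) (inj₁ z) = sgn f z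
sgn (f ⊕ g) (inj₂ z) = sgn g z
sgn (⊖ f) z          = not (sgn f z)
sgn (ε f) z          = sgn f z
sgn (f ⊗ g) (z , y)  = if sgn f z then sgn g y else not (sgn g y)

enumVar : ∀ N (f : Expr) → List (Var N f)
enumVar N 𝟙       = tt ∷ []
enumVar N (q j)   = tt ∷ []
enumVar N (𝐱ₙ n)  = allFin n
enumVar N 𝐱       = allFin N
enumVar N (f ⊕ g) = map inj₁ (enumVar N f) Data.List.++ map inj₂ (enumVar N g)
enumVar N (⊖ f)   = enumVar N f
enumVar N (ε f)   = enumVar N f
enumVar N (f ⊗ g) = concatMap (λ z → map (z ,_) (enumVar N g)) (enumVar N f)

anyB : ∀ {A : Set} → (A → Bool) → List A → Bool
anyB p = foldr (λ a r → p a ∨ r) false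

allB : ∀ {A : Set} → (A → Bool) → List A → Bool
allB p = foldr (λ a r → p a ∧ r) true

countB : ∀ {A : Set} → (A → Bool) → List A → ℕ
countB p xs = length (filterᵇ p xs)

funs : ∀ {A : Set} → List A → (k : ℕ) → List (Fin k → A)
funs xs zero    = (λ ()) ∷ []
funs xs (suc k) = concatMap (λ a → map (λ g → λ { Fin.zero → a ; (Fin.suc i) → g i }) (funs xs k)) xs

reach : ∀ {n} → List (Fin n × Fin n) → ℕ → Fin n → Fin n → Bool
reach arcs zero    u v = ⌊ u ≟F v ⌋
reach arcs (suc k) u v =
  reach arcs k u v ∨ anyB (λ { (a , b) → reach arcs k u a ∧ ⌊ b ≟F v ⌋ }) arcs

-- Number of connected components of the graph with vertex set
-- {v | inV v} and undirected edges given by arcs (both directions listed):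
-- count the vertices that are the least vertex of their component.
components : ∀ {n} → (Fin n → Bool) → List (Fin n × Fin n) → ℕ
components {n} inV arcs =
  countB (λ v → inV v ∧ allB (λ u → not (inV u ∧ (toℕ u <ᵇ toℕ v) ∧ reach arcs n u v)) (allFin n))
         (allFin n)

-- Biorientations: for edge e with ends e = (a , b),
--   ⟶ : singly directed a → b,  ⟵ : singly directed b → a,  ⟷ : bidirected.

data Ori : Set where
  ⟶ ⟵ ⟷ : Ori

allOri : List Ori
allOri = ⟶ ∷ ⟵ ∷ ⟷ ∷ []

isBi : Ori → Bool
isBi ⟷ = true
isBi _ = false

module _ (G : Graph) where
  open Graph G

  Biorientation : Set
  Biorientation = Fin nE → Ori

  allBiorientations : List Biorientation
  allBiorientations = funs allOri nE

  arcsOf : Ori → Fin nV × Fin nV → List (Fin nV × Fin nV)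
  arcsOf ⟶ (a , b) = (a , b) ∷ []
  arcsOf ⟵ (a , b) = (b , a) ∷ []
  arcsOf ⟷ (a , b) = (a , b) ∷ (b , a) ∷ []

  singleArcsOf : Ori → Fin nV × Fin nV → List (Fin nV × Fin nV)
  singleArcsOf ⟷ _ = []
  singleArcsOf o e  = arcsOf o e

  arcs : Biorientation → List (Fin nV × Fin nV)
  arcs γ = concatMap (λ e → arcsOf (γ e) (ends e)) (allFin nE)

  singleArcs : Biorientation → List (Fin nV × Fin nV)
  singleArcs γ = concatMap (λ e → singleArcsOf (γ e) (ends e)) (allFin nE)

  -- γ is acyclic iff there is no directed cycle using a singly directed
  -- edge, i.e. no singly directed arc a → b with a directed walk from b
  -- back to a (walks of length ≤ nV suffice).
  acyclic : Biorientation → Bool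
  acyclic γ = allB (λ { (a , b) → not (reach (arcs γ) nV b a) }) (singleArcs γ)

  numBi : Biorientation → ℕ
  numBi γ = countB (λ e → isBi (γ e)) (allFin nE)

  allEdgeSubsets : List (Fin nE → Bool)
  allEdgeSubsets = funs (true ∷ false ∷ []) nE

  arcsSub : (Fin nE → Bool) → List (Fin nV × Fin nV)
  arcsSub S = concatMap (λ e → if S e then arcsOf ⟷ (ends e) else []) (allFin nE)

-- Identities of formal power series in
-- t, q_j, x_1, x_2, … with integer coefficients are stated as
-- identities in an arbitrary commutative ring R under arbitrary values
-- of t, q_j and x_1,…,x_N (x_i = 0 for i > N), for every N.

module _ {c ℓ : Level} (R : CommutativeRing c ℓ) where
  open CommutativeRing R

  pow : Carrier → ℕ → Carrier
  pow a zero    = 1#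
  pow a (suc k) = a * pow a k

  sumL : ∀ {A : Set} → List A → (A → Carrier) → Carrier
  sumL xs h = foldr (λ a s → h a + s) 0# xs

  prodL : ∀ {A : Set} → List A → (A → Carrier) → Carrier
  prodL xs h = foldr (λ a s → h a * s) 1# xs

  -- value of x_{i+1} given values of x_1..x_N (zero beyond N)
  xval : ∀ {N} → (Fin N → Carrier) → ℕ → Carrier
  xval {zero}  xv i       = 0#
  xval {suc N} xv zero    = xv Fin.zero
  xval {suc N} xv (suc i) = xval (xv ∘ Fin.suc) i

  val : ∀ {N} (qv : ℕ → Carrier) (xv : Fin N → Carrier) (f : Expr) → Var N f → Carrier
  val qv xv 𝟙 _              = 1#
  val qv xv (q j) _          = qv j
  val qv xv (𝐱ₙ n) i         = xval xv (toℕ i)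
  val qv xv 𝐱 i              = xv i
  val qv xv (f ⊕ g) (inj₁ z) = val qv xv f z
  val qv xv (f ⊕ g) (inj₂ z) = val qv xv g z
  val qv xv (⊖ f) z          = val qv xv f z
  val qv xv (ε f) z          = - val qv xv f z
  val qv xv (f ⊗ g) (z , y)  = val qv xv f z * val qv xv g y

  pPleth : ∀ {N} (qv : ℕ → Carrier) (xv : Fin N → Carrier) → ℕ → Expr → Carrier
  pPleth qv xv k 𝟙       = 1#
  pPleth qv xv k (q j)   = pow (qv j) k
  pPleth qv xv k (𝐱ₙ n)  = sumL (allFin n) (λ i → pow (xval xv (toℕ i)) k)
  pPleth {N} qv xv k 𝐱   = sumL (allFin N) (λ i → pow (xv i) k)
  pPleth qv xv k (f ⊕ g) = pPleth qv xv k f + pPleth qv xv k g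
  pPleth qv xv k (⊖ f)   = - pPleth qv xv k f
  pPleth qv xv k (ε f)   = pow (- 1#) k * pPleth qv xv k f
  pPleth qv xv k (f ⊗ g) = pPleth qv xv k f * pPleth qv xv k g

  -- XB_{(G,w)}[f], using the power-sum expansion
  --   XB_{(G,w)} = Σ_{S ⊆ E} t^{|S|} Π_{C comp. of (V,S)} p_{w(C)}
  -- and plethysm (t a constant).
  XBpleth : (G : Graph) (w : Fin (Graph.nV G) → ℕ) (N : ℕ) (f : Expr)
            (t : Carrier) (qv : ℕ → Carrier) (xv : Fin N → Carrier) → Carrier
  XBpleth G w N f t qv xv =
    sumL (allEdgeSubsets G) λ S →
      pow t (countB S (allFin nE))
      * prodL (filterᵇ (isRep S) (allFin nV))
              (λ v → pPleth qv xv (compWeight S v) f)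
    where
    open Graph G
    isRep : (Fin nE → Bool) → Fin nV → Bool
    isRep S v = allB (λ u → not ((toℕ u <ᵇ toℕ v) ∧ reach (arcsSub G S) nV u v)) (allFin nV)
    compWeight : (Fin nE → Bool) → Fin nV → ℕ
    compWeight S v = foldr ℕ._+_ 0 (map w (filterᵇ (λ u → reach (arcsSub G S) nV v u) (allFin nV)))

  RHS : (G : Graph) (w : Fin (Graph.nV G) → ℕ) (N : ℕ) (f : Expr)
        {ℓ' : Level} (_<_ : Rel (Var N f) ℓ') (cmp : Trichotomous _≡_ _<_)
        (t : Carrier) (qv : ℕ → Carrier) (xv : Fin N → Carrier) → Carrier
  RHS G w N f _<_ cmp t qv xv =
    sumL (allBiorientations G) λ γ →
    sumL (funs (enumVar N f) nV) λ κ →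
      if acyclic G γ ∧ allB (λ e → compatible κ (ends e) (γ e)) (allFin nE)
      then pow (1# + t) (numBi G γ)
           * pow (- 1#) (cN γ κ)
           * prodL (allFin nV) (λ v → pow (val qv xv f (κ v)) (w v))
      else 0#
    where
    open Graph G
    compatible : (Fin nV → Var N f) → Fin nV × Fin nV → Ori → Bool
    compatible κ (a , b) o with cmp (κ a) (κ b)
    ... | tri< _ _ _ = isFwd o where
      isFwd : Ori → Bool
      isFwd ⟶ = true
      isFwd _ = false
    ... | tri> _ _ _ = isBwd o where
      isBwd : Ori → Bool
      isBwd ⟵ = true
      isBwd _ = false
    ... | tri≈ _ _ _ = if sgn f (κ a) then isBi o else true
    cN : Biorientation G → (Fin nV → Var N f) → ℕ
    cN γ κ = components neg arcsN
      where
      neg : Fin nV → Bool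
      neg v = not (sgn f (κ v))
      arcsN : List (Fin nV × Fin nV)
      arcsN = concatMap (λ e → if isBi (γ e) ∧ neg (Data.Product.proj₁ (ends e)) ∧ neg (Data.Product.proj₂ (ends e))
                                then arcsOf G ⟷ (ends e) else []) (allFin nE)

{-# OPTIONS --safe #-}
module Submission where

-- Both sides are expanded over colourings κ : V(G) → Var(f) and compared at each monomial
-- Π_v κ(v)^w(v).  On the left, p_k[f] = Σ_z sgn(z) z^k turns XB = Σ_S t^|S| Π_C p_w(C)
-- into a sum over colourings constant on the components C of (V,S), and the signs of the
-- negatively coloured components multiply to (-1)^c(N); the coefficient of κ is therefore
-- Σ_{S ⊆ E} t^|S| [κ constant on S] (-1)^c(N_κ(S)), which obeys, edge by edge, the
-- deletion–contraction recurrence F(e ∷ es, P) = F(es, P) + t F(es, e ∷ P).  The sum over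
-- compatible acyclic biorientations obeys the same recurrence.  If κ(a) ≠ κ(b) exactly one
-- single orientation of e = ab is compatible, and as κ increases along arcs it closes no
-- cycle.  If κ(a) = κ(b), the bidirected orientation contributes (1+t) times the contracted
-- term; its t-part is the contraction, and its 1-part together with the two single
-- orientations adds up to the deleted term: for a positive colour the single orientations
-- are incompatible, and for a negative one they are either killed by cycles or, when a and b
-- lie in different components of N, both survive and cancel against the sign flip caused by
-- merging two components.

open import Defs
open import Level using (Level)
open import Function using (_∘_; id; Equivalence)
open import Data.Empty using (⊥; ⊥-elim)
open import Data.Unit using (tt)
open import Data.Product using (Σ; ∃; _×_; _,_; proj₁; proj₂)
open import Data.Sum as S using (_⊎_; inj₁; inj₂)
open import Data.Bool using (Bool; true; false; _∧_; _∨_; not; if_then_else_; T)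
open import Data.Bool.Properties as BP using (T-∧; T-∨; T-≡; T-not-≡)
open import Data.Nat as ℕ using (ℕ; zero; suc; _≤_; _<ᵇ_)
import Data.Nat.Properties as ℕP
open import Data.Fin as F using (Fin; toℕ; inject₁; fromℕ)
import Data.Fin.Properties as FP
open FP using () renaming (_≟_ to _≟F_)
import Data.Fin.Relation.Unary.Top as Top
open Top using (‵fromℕ; ‵inject₁)
open import Data.Vec.Functional using () renaming (_∷_ to _∷ᶠ_)
open import Data.List as L using (List; []; _∷_; _++_; map; foldr; concatMap; allFin; length; filterᵇ; tabulate)
import Data.List.Properties as LP
open import Data.List.Membership.Propositional using (_∈_; find; lose)
import Data.List.Membership.Propositional.Properties as MP
open import Data.List.Relation.Unary.Any using (here; there)
open import Data.List.Relation.Unary.All as All using ()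
open import Data.List.Relation.Unary.All.Properties using (¬Any⇒All¬)
import Data.List.Relation.Unary.AllPairs as AllPairs
open import Data.List.Relation.Unary.Unique.Propositional using (Unique)
import Data.List.Relation.Unary.Unique.Propositional.Properties as Unique
open import Data.List.Relation.Binary.Subset.Propositional using (_⊆_)
import Data.List.Relation.Binary.Subset.Propositional.Properties as Subset
open import Data.List.Relation.Binary.Permutation.Propositional using (_↭_; ↭-sym)
import Data.List.Relation.Binary.Permutation.Propositional.Properties as PermProps
open import Relation.Nullary using (¬_; Dec; yes; no)
open import Relation.Nullary.Decidable using (⌊_⌋; toWitness; fromWitness)
open import Relation.Nullary.Decidable.Core using (T?)
open import Relation.Binary.Core using (Rel)
open import Relation.Binary.Definitions using (Tri; tri<; tri≈; tri>; Reflexive; Transitive; DecidableEquality)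
open import Relation.Binary.Structures using (IsEquivalence; IsPartialOrder; IsStrictTotalOrder)
import Relation.Binary.Construct.StrictToNonStrict as NonStrict
open import Relation.Binary.PropositionalEquality using (_≡_; _≢_; refl; sym; trans; cong; cong₂; subst)
open import Algebra.Bundles using (CommutativeRing)
import Algebra.Properties.Ring as RingProperties
import Algebra.Solver.Ring.NaturalCoefficients.Default as NaturalCoefficients
import Relation.Binary.Reasoning.Setoid as SetoidReasoning

T-⇔⇒≡ : ∀ {a b} → (T a → T b) → (T b → T a) → a ≡ b
T-⇔⇒≡ {true}  {true}  _ _ = refl
T-⇔⇒≡ {true}  {false} f _ = ⊥-elim (f tt)
T-⇔⇒≡ {false} {true}  _ g = ⊥-elim (g tt)
T-⇔⇒≡ {false} {false} _ _ = refl

T-∧⁻ : ∀ {a b} → T (a ∧ b) → T a × T b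
T-∧⁻ = Equivalence.to T-∧

T-∧⁺ : ∀ {a b} → T a → T b → T (a ∧ b)
T-∧⁺ x y = Equivalence.from T-∧ (x , y)

T-∨⁻ : ∀ {a b} → T (a ∨ b) → T a ⊎ T b
T-∨⁻ = Equivalence.to T-∨

T-∨⁺ˡ : ∀ {a b} → T a → T (a ∨ b)
T-∨⁺ˡ x = Equivalence.from T-∨ (inj₁ x)

T-∨⁺ʳ : ∀ {a b} → T b → T (a ∨ b)
T-∨⁺ʳ y = Equivalence.from T-∨ (inj₂ y)

T-not⁻ : ∀ {a} → T (not a) → ¬ T a
T-not⁻ {false} _ ()

T-not⁺ : ∀ {a} → ¬ T a → T (not a)
T-not⁺ {false} _ = tt
T-not⁺ {true}  h = h tt

T⇒≡true : ∀ {a} → T a → a ≡ true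
T⇒≡true = Equivalence.to T-≡

¬T⇒≡false : ∀ {a} → ¬ T a → a ≡ false
¬T⇒≡false h = Equivalence.to T-not-≡ (T-not⁺ h)

module _ {A : Set} where

  allB⁻ : ∀ {p : A → Bool} {xs} → T (allB p xs) → ∀ {x} → x ∈ xs → T (p x)
  allB⁻ {p} {y ∷ _}  h (here refl) = proj₁ (T-∧⁻ {p y} h)
  allB⁻ {p} {y ∷ xs} h (there m)   = allB⁻ {p} {xs} (proj₂ (T-∧⁻ {p y} h)) m

  allB⁺ : ∀ {p : A → Bool} {xs} → (∀ {x} → x ∈ xs → T (p x)) → T (allB p xs)
  allB⁺ {p} {[]}     h = tt
  allB⁺ {p} {y ∷ xs} h = T-∧⁺ {p y} (h (here refl)) (allB⁺ {p} {xs} (h ∘ there))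

  anyB⁻ : ∀ {p : A → Bool} {xs} → T (anyB p xs) → ∃ λ x → x ∈ xs × T (p x)
  anyB⁻ {p} {y ∷ xs} h with T-∨⁻ {p y} h
  ... | inj₁ py = y , here refl , py
  ... | inj₂ r  = let x , m , px = anyB⁻ {p} {xs} r in x , there m , px

  anyB⁺ : ∀ {p : A → Bool} {xs x} → x ∈ xs → T (p x) → T (anyB p xs)
  anyB⁺ {p} {y ∷ _}  (here refl) px = T-∨⁺ˡ {p y} px
  anyB⁺ {p} {y ∷ xs} (there m)   px = T-∨⁺ʳ {p y} (anyB⁺ {p} {xs} m px)

  allB-cong : ∀ {p p′ : A → Bool} xs → (∀ x → x ∈ xs → p x ≡ p′ x) → allB p xs ≡ allB p′ xs
  allB-cong []       h = refl
  allB-cong (x ∷ xs) h = cong₂ _∧_ (h x (here refl)) (allB-cong xs (λ y → h y ∘ there))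

  allB-⊆ : ∀ {p : A → Bool} {xs ys} → xs ⊆ ys → T (allB p ys) → T (allB p xs)
  allB-⊆ {p} {xs} {ys} xs⊆ys h = allB⁺ {p} {xs} (allB⁻ {p} {ys} h ∘ xs⊆ys)

  filterᵇ-∷ : ∀ (p : A → Bool) x xs → filterᵇ p (x ∷ xs) ≡ (if p x then x ∷ filterᵇ p xs else filterᵇ p xs)
  filterᵇ-∷ p x xs with p x
  ... | true  = refl
  ... | false = refl

  countB-cong : ∀ {p p′ : A → Bool} xs → (∀ x → x ∈ xs → p x ≡ p′ x) → countB p xs ≡ countB p′ xs
  countB-cong {p} {p′} []       h = refl
  countB-cong {p} {p′} (x ∷ xs) h rewrite filterᵇ-∷ p x xs | filterᵇ-∷ p′ x xs | h x (here refl) with p′ x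
  ... | true  = cong suc (countB-cong xs (λ y → h y ∘ there))
  ... | false = countB-cong xs (λ y → h y ∘ there)

  countB-≡suc : ∀ (p p′ : A → Bool) xs m → Unique xs → m ∈ xs → T (p m) → ¬ T (p′ m) →
                (∀ x → x ∈ xs → x ≢ m → p x ≡ p′ x) → countB p xs ≡ suc (countB p′ xs)
  countB-≡suc p p′ (y ∷ ys) m (y∉ AllPairs.∷ uq) (here refl) pm ¬p′m same
    rewrite filterᵇ-∷ p y ys | filterᵇ-∷ p′ y ys | T⇒≡true pm | ¬T⇒≡false ¬p′m =
      cong suc (countB-cong ys (λ x mx → same x (there mx) (λ { refl → All.lookup y∉ mx refl })))
  countB-≡suc p p′ (y ∷ ys) m (y∉ AllPairs.∷ uq) (there mm) pm ¬p′m same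
    rewrite filterᵇ-∷ p y ys | filterᵇ-∷ p′ y ys | same y (here refl) (All.lookup y∉ mm) with p′ y
  ... | true  = cong suc (countB-≡suc p p′ ys m uq mm pm ¬p′m (λ x → same x ∘ there))
  ... | false = countB-≡suc p p′ ys m uq mm pm ¬p′m (λ x → same x ∘ there)

module _ {A B : Set} (g : A → List B) where

  ∈-concatMap⁻-∃ : ∀ xs {y} → y ∈ concatMap g xs → ∃ λ x → x ∈ xs × y ∈ g x
  ∈-concatMap⁻-∃ xs = find ∘ MP.∈-concatMap⁻ g {xs}

  ∈-concatMap⁺-∃ : ∀ {xs x y} → x ∈ xs → y ∈ g x → y ∈ concatMap g xs
  ∈-concatMap⁺-∃ x∈ y∈ = MP.∈-concatMap⁺ g (lose x∈ y∈)

tabulate-∷ʳ : ∀ {A : Set} n (f : Fin (suc n) → A) → tabulate f ≡ tabulate (f ∘ inject₁) ++ f (fromℕ n) ∷ []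
tabulate-∷ʳ zero    f = refl
tabulate-∷ʳ (suc n) f = cong (f F.zero ∷_) (tabulate-∷ʳ n (f ∘ F.suc))

allFin-∷ʳ : ∀ n → allFin (suc n) ≡ map inject₁ (allFin n) ++ fromℕ n ∷ []
allFin-∷ʳ n = trans (tabulate-∷ʳ n id) (cong (_++ fromℕ n ∷ []) (sym (LP.map-tabulate id inject₁)))

toℕ-inject₁<toℕ-fromℕ : ∀ {n} (i : Fin n) → toℕ (inject₁ i) ℕ.< toℕ (fromℕ n)
toℕ-inject₁<toℕ-fromℕ {n} i rewrite FP.toℕ-inject₁ i | FP.toℕ-fromℕ n = FP.toℕ<n i

module _ {A B : Set} where

  filterᵇ-map : ∀ (p : B → Bool) (f : A → B) xs → filterᵇ p (map f xs) ≡ map f (filterᵇ (p ∘ f) xs)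
  filterᵇ-map p f []       = refl
  filterᵇ-map p f (x ∷ xs) rewrite filterᵇ-∷ p (f x) (map f xs) | filterᵇ-∷ (p ∘ f) x xs with p (f x)
  ... | true  = cong (f x ∷_) (filterᵇ-map p f xs)
  ... | false = filterᵇ-map p f xs

  concatMap-tabulate : ∀ {C : Set} n (g : A → List C) (h : Fin n → A) (g′ : B → List C) (h′ : Fin n → B) →
                       (∀ i → g (h i) ≡ g′ (h′ i)) → concatMap g (tabulate h) ≡ concatMap g′ (tabulate h′)
  concatMap-tabulate zero    g h g′ h′ e = refl
  concatMap-tabulate (suc n) g h g′ h′ e = cong₂ _++_ (e F.zero) (concatMap-tabulate n g (h ∘ F.suc) g′ (h′ ∘ F.suc) (e ∘ F.suc))

  allB-tabulate : ∀ n (p : A → Bool) (h : Fin n → A) (p′ : B → Bool) (h′ : Fin n → B) →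
                  (∀ i → p (h i) ≡ p′ (h′ i)) → allB p (tabulate h) ≡ allB p′ (tabulate h′)
  allB-tabulate zero    p h p′ h′ e = refl
  allB-tabulate (suc n) p h p′ h′ e = cong₂ _∧_ (e F.zero) (allB-tabulate n p (h ∘ F.suc) p′ (h′ ∘ F.suc) (e ∘ F.suc))

  countB-tabulate : ∀ n (p : A → Bool) (h : Fin n → A) (p′ : B → Bool) (h′ : Fin n → B) →
                    (∀ i → p (h i) ≡ p′ (h′ i)) → countB p (tabulate h) ≡ countB p′ (tabulate h′)
  countB-tabulate zero    p h p′ h′ e = refl
  countB-tabulate (suc n) p h p′ h′ e
    rewrite filterᵇ-∷ p (h F.zero) (tabulate (h ∘ F.suc)) | filterᵇ-∷ p′ (h′ F.zero) (tabulate (h′ ∘ F.suc)) | e F.zero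
    with p′ (h′ F.zero)
  ... | true  = cong suc (countB-tabulate n p (h ∘ F.suc) p′ (h′ ∘ F.suc) (e ∘ F.suc))
  ... | false = countB-tabulate n p (h ∘ F.suc) p′ (h′ ∘ F.suc) (e ∘ F.suc)

-- Walks and reachability

module Walks (n : ℕ) where

  open import Data.List.Membership.DecPropositional (_≟F_ {n}) using (_∈?_)

  Arc : Set
  Arc = Fin n × Fin n

  data Walk (A : List Arc) (u : Fin n) : Fin n → Set where
    nil : Walk A u u
    _▷_ : ∀ {a b} → Walk A u a → (a , b) ∈ A → Walk A u b

  infixl 5 _▷_

  Reach : List Arc → Fin n → Fin n → Set
  Reach A u v = T (reach A n u v)

  both : Arc → List Arc
  both (a , b) = (a , b) ∷ (b , a) ∷ []

  both-endpoints : ∀ {a b x} → x ∈ both (a , b) → proj₁ x ∈ a ∷ b ∷ [] × proj₂ x ∈ a ∷ b ∷ []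
  both-endpoints (here refl)         = here refl , there (here refl)
  both-endpoints (there (here refl)) = there (here refl) , here refl

  module _ {A : List Arc} where

    steps : ∀ {u v} → Walk A u v → ℕ
    steps nil     = 0
    steps (w ▷ _) = suc (steps w)

    vertices : ∀ {u v} → Walk A u v → List (Fin n)
    vertices {u} nil       = u ∷ []
    vertices (_▷_ {b = b} w _) = b ∷ vertices w

    length-vertices : ∀ {u v} (w : Walk A u v) → length (vertices w) ≡ suc (steps w)
    length-vertices nil     = refl
    length-vertices (w ▷ _) = cong suc (length-vertices w)

    Path : Fin n → Fin n → Set
    Path u v = Σ (Walk A u v) (Unique ∘ vertices)

    truncate : ∀ {u a b} (p : Path u a) → b ∈ vertices (proj₁ p) → Path u b
    truncate (nil   , uq)             (here refl) = nil , uq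
    truncate (w ▷ m , uq)             (here refl) = w ▷ m , uq
    truncate (w ▷ _ , _ AllPairs.∷ uq) (there b∈)  = truncate (w , uq) b∈

    toPath : ∀ {u v} → Walk A u v → Path u v
    toPath nil = nil , All.[] AllPairs.∷ AllPairs.[]
    toPath (_▷_ {b = b} w m) with toPath w
    ... | p with b ∈? vertices (proj₁ p)
    ...   | yes b∈ = truncate p b∈
    ...   | no  b∉ = proj₁ p ▷ m , ¬Any⇒All¬ _ b∉ AllPairs.∷ proj₂ p

    reach⇒Walk : ∀ k {u v} → T (reach A k u v) → Walk A u v
    reach⇒Walk zero    h = subst (Walk A _) (toWitness h) nil
    reach⇒Walk (suc k) {u} {v} h with T-∨⁻ {reach A k u v} h
    ... | inj₁ r = reach⇒Walk k r
    ... | inj₂ r with anyB⁻ {xs = A} r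
    ...   | (a , b) , m , r′ with T-∧⁻ {reach A k u a} r′
    ...     | ra , b≡v = subst (Walk A u) (toWitness b≡v) (reach⇒Walk k ra ▷ m)

    Walk⇒reach : ∀ {u v} (w : Walk A u v) k → steps w ≤ k → T (reach A k u v)
    Walk⇒reach nil zero    _ = fromWitness refl
    Walk⇒reach {u} nil (suc k) _ = T-∨⁺ˡ {reach A k u u} (Walk⇒reach nil k ℕ.z≤n)
    Walk⇒reach {u} (_▷_ {a = a} {b = b} w m) (suc k) (ℕ.s≤s le) =
      T-∨⁺ʳ {reach A k u b} (anyB⁺ {xs = A} m (T-∧⁺ {reach A k u a} (Walk⇒reach w k le) (fromWitness refl)))

  unique⇒length≤ : ∀ {xs : List (Fin n)} → Unique xs → length xs ≤ n
  unique⇒length≤ {xs} uq = FP.injective⇒≤ (lookup-injective uq)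
    where
    lookup-injective : ∀ {xs : List (Fin n)} → Unique xs → ∀ {i j} → L.lookup xs i ≡ L.lookup xs j → i ≡ j
    lookup-injective (_ AllPairs.∷ _)   {F.zero}  {F.zero}  _ = refl
    lookup-injective (x∉ AllPairs.∷ _)  {F.zero}  {F.suc j} e = ⊥-elim (All.lookup x∉ (MP.∈-lookup j) e)
    lookup-injective (x∉ AllPairs.∷ _)  {F.suc i} {F.zero}  e = ⊥-elim (All.lookup x∉ (MP.∈-lookup i) (sym e))
    lookup-injective (_ AllPairs.∷ uq)  {F.suc i} {F.suc j} e = cong F.suc (lookup-injective uq e)

  Reach⇒Walk : ∀ {A u v} → Reach A u v → Walk A u v
  Reach⇒Walk = reach⇒Walk n

  -- walks of at most n steps suffice because a shortest walk visits no vertex twice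
  Walk⇒Reach : ∀ {A u v} → Walk A u v → Reach A u v
  Walk⇒Reach w with toPath w
  ... | p , uq = Walk⇒reach p n (ℕP.<⇒≤ (subst (_≤ n) (length-vertices p) (unique⇒length≤ uq)))

  module _ {A : List Arc} where

    _++ᵂ_ : ∀ {u v x} → Walk A u v → Walk A v x → Walk A u x
    w ++ᵂ nil      = w
    w ++ᵂ (w′ ▷ m) = (w ++ᵂ w′) ▷ m

    arc : ∀ {u v} → (u , v) ∈ A → Walk A u v
    arc m = nil ▷ m

    Symmetric : Set
    Symmetric = ∀ {a b} → (a , b) ∈ A → (b , a) ∈ A

    reverse : Symmetric → ∀ {u v} → Walk A u v → Walk A v u
    reverse s nil     = nil
    reverse s (w ▷ m) = arc (s m) ++ᵂ reverse s w

    walk-preserves : ∀ {ℓ} (_∼_ : Fin n → Fin n → Set ℓ) → Reflexive _∼_ → Transitive _∼_ →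
                     (∀ {a b} → (a , b) ∈ A → a ∼ b) → ∀ {u v} → Walk A u v → u ∼ v
    walk-preserves _∼_ rfl trn step nil     = rfl
    walk-preserves _∼_ rfl trn step (w ▷ m) = trn (walk-preserves _∼_ rfl trn step w) (step m)

    walk-restrict : ∀ {ℓ} (P : Fin n → Set ℓ) {B : List Arc} →
                    (∀ {a b} → (a , b) ∈ A → P a → P b × (a , b) ∈ B) →
                    ∀ {u v} → Walk A u v → P u → P v × Walk B u v
    walk-restrict P step nil     pu = pu , nil
    walk-restrict P step (w ▷ m) pu with walk-restrict P step w pu
    ... | pa , w′ with step m pa
    ...   | pb , m′ = pb , w′ ▷ m′

  map-Walk : ∀ {A B : List Arc} → A ⊆ B → ∀ {u v} → Walk A u v → Walk B u v
  map-Walk A⊆B nil     = nil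
  map-Walk A⊆B (w ▷ m) = map-Walk A⊆B w ▷ A⊆B m

  Reach-⊆ : ∀ {A B} → A ⊆ B → ∀ {u v} → Reach A u v → Reach B u v
  Reach-⊆ A⊆B = Walk⇒Reach ∘ map-Walk A⊆B ∘ Reach⇒Walk

  reach-≐ : ∀ {A B} → A ⊆ B → B ⊆ A → ∀ u v → reach A n u v ≡ reach B n u v
  reach-≐ A⊆B B⊆A u v = T-⇔⇒≡ (Reach-⊆ A⊆B) (Reach-⊆ B⊆A)

  Reach-refl : ∀ {A} u → Reach A u u
  Reach-refl u = Walk⇒Reach nil

  Reach-sym : ∀ {A} → Symmetric {A} → ∀ {u v} → Reach A u v → Reach A v u
  Reach-sym s = Walk⇒Reach ∘ reverse s ∘ Reach⇒Walk

  Reach-trans : ∀ {A u v x} → Reach A u v → Reach A v x → Reach A u x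
  Reach-trans r r′ = Walk⇒Reach (Reach⇒Walk r ++ᵂ Reach⇒Walk r′)

  split-first : ∀ B {A : List Arc} {u v} → Walk (B ++ A) u v →
                Walk A u v ⊎ (∃ λ x → x ∈ B × Walk A u (proj₁ x) × Walk (B ++ A) (proj₂ x) v)
  split-first B nil = inj₁ nil
  split-first B (_▷_ {a = a} {b = b} w m) with split-first B w
  ... | inj₂ (x , x∈ , w₁ , w₂) = inj₂ (x , x∈ , w₁ , w₂ ▷ m)
  ... | inj₁ w₀ with MP.∈-++⁻ B m
  ...   | inj₁ m∈B = inj₂ ((a , b) , m∈B , w₀ , nil)
  ...   | inj₂ m∈A = inj₁ (w₀ ▷ m∈A)

  split-last : ∀ B {A : List Arc} {u v} → Walk (B ++ A) u v →
               Walk A u v ⊎ (∃ λ x → x ∈ B × Walk (B ++ A) u (proj₁ x) × Walk A (proj₂ x) v)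
  split-last B nil = inj₁ nil
  split-last B (_▷_ {a = a} {b = b} w m) with MP.∈-++⁻ B m
  ... | inj₁ m∈B = inj₂ ((a , b) , m∈B , w , nil)
  ... | inj₂ m∈A with split-last B w
  ...   | inj₁ w₀ = inj₁ (w₀ ▷ m∈A)
  ...   | inj₂ (x , x∈ , w₁ , w₂) = inj₂ (x , x∈ , w₁ , w₂ ▷ m∈A)

  replace-arcs : ∀ B {A} → (∀ {x} → x ∈ B → Walk A (proj₁ x) (proj₂ x)) → ∀ {u v} → Walk (B ++ A) u v → Walk A u v
  replace-arcs B h nil = nil
  replace-arcs B h (w ▷ m) with MP.∈-++⁻ B m
  ... | inj₁ m∈B = replace-arcs B h w ++ᵂ h m∈B
  ... | inj₂ m∈A = replace-arcs B h w ▷ m∈A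

-- Finite sums and products in a commutative ring

module RingSums {c ℓ : Level} (R : CommutativeRing c ℓ) where
  open CommutativeRing R hiding (refl; sym; trans)
  open CommutativeRing R public using () renaming (refl to ≈-refl; sym to ≈-sym; trans to ≈-trans)
  open SetoidReasoning setoid public
  open NaturalCoefficients commutativeSemiring public using (solve; _:=_; _:+_; _:*_; con)

  Σ[_]_ : ∀ {A : Set} → List A → (A → Carrier) → Carrier
  Σ[ xs ] f = sumL R xs f

  Π[_]_ : ∀ {A : Set} → List A → (A → Carrier) → Carrier
  Π[ xs ] f = prodL R xs f

  -1# : Carrier
  -1# = - 1#

  ⟦_⟧ : Bool → Carrier → Carrier
  ⟦ b ⟧ x = if b then x else 0#

  module _ {A : Set} where

    Σ-cong-∈ : ∀ (xs : List A) {f g : A → Carrier} → (∀ a → a ∈ xs → f a ≈ g a) → Σ[ xs ] f ≈ Σ[ xs ] g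
    Σ-cong-∈ []       h = ≈-refl
    Σ-cong-∈ (x ∷ xs) h = +-cong (h x (here refl)) (Σ-cong-∈ xs (λ a → h a ∘ there))

    Σ-cong : ∀ (xs : List A) {f g : A → Carrier} → (∀ a → f a ≈ g a) → Σ[ xs ] f ≈ Σ[ xs ] g
    Σ-cong xs h = Σ-cong-∈ xs (λ a _ → h a)

    Π-cong-∈ : ∀ (xs : List A) {f g : A → Carrier} → (∀ a → a ∈ xs → f a ≈ g a) → Π[ xs ] f ≈ Π[ xs ] g
    Π-cong-∈ []       h = ≈-refl
    Π-cong-∈ (x ∷ xs) h = *-cong (h x (here refl)) (Π-cong-∈ xs (λ a → h a ∘ there))

    Σ-++ : ∀ (xs ys : List A) f → Σ[ xs ++ ys ] f ≈ Σ[ xs ] f + Σ[ ys ] f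
    Σ-++ []       ys f = ≈-sym (+-identityˡ _)
    Σ-++ (x ∷ xs) ys f = ≈-trans (+-cong ≈-refl (Σ-++ xs ys f)) (≈-sym (+-assoc _ _ _))

    Π-++ : ∀ (xs ys : List A) f → Π[ xs ++ ys ] f ≈ Π[ xs ] f * Π[ ys ] f
    Π-++ []       ys f = ≈-sym (*-identityˡ _)
    Π-++ (x ∷ xs) ys f = ≈-trans (*-cong ≈-refl (Π-++ xs ys f)) (≈-sym (*-assoc _ _ _))

    Σ-+ : ∀ (xs : List A) f g → Σ[ xs ] (λ a → f a + g a) ≈ Σ[ xs ] f + Σ[ xs ] g
    Σ-+ []       f g = ≈-sym (+-identityˡ _)
    Σ-+ (x ∷ xs) f g = ≈-trans (+-cong ≈-refl (Σ-+ xs f g))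
      (solve 4 (λ a b c d → (a :+ b) :+ (c :+ d) := (a :+ c) :+ (b :+ d)) ≈-refl (f x) (g x) _ _)

    *-Σ : ∀ (xs : List A) k f → k * Σ[ xs ] f ≈ Σ[ xs ] (λ a → k * f a)
    *-Σ []       k f = zeroʳ k
    *-Σ (x ∷ xs) k f = ≈-trans (distribˡ k _ _) (+-cong ≈-refl (*-Σ xs k f))

    Σ-* : ∀ (xs : List A) k f → Σ[ xs ] f * k ≈ Σ[ xs ] (λ a → f a * k)
    Σ-* xs k f = ≈-trans (*-comm _ k) (≈-trans (*-Σ xs k f) (Σ-cong xs (λ a → *-comm k _)))

    -‿Σ : ∀ (xs : List A) f → - Σ[ xs ] f ≈ Σ[ xs ] (λ a → - f a)
    -‿Σ []       f = RingProperties.-0#≈0# ring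
    -‿Σ (x ∷ xs) f = ≈-trans (≈-sym (RingProperties.-‿+-comm ring _ _)) (+-cong ≈-refl (-‿Σ xs f))

    Σ-0 : ∀ (xs : List A) f → (∀ a → f a ≈ 0#) → Σ[ xs ] f ≈ 0#
    Σ-0 []       f h = ≈-refl
    Σ-0 (x ∷ xs) f h = ≈-trans (+-cong (h x) (Σ-0 xs f h)) (+-identityˡ _)

    Π-* : ∀ (xs : List A) f g → Π[ xs ] (λ a → f a * g a) ≈ Π[ xs ] f * Π[ xs ] g
    Π-* []       f g = ≈-sym (*-identityˡ _)
    Π-* (x ∷ xs) f g = ≈-trans (*-cong ≈-refl (Π-* xs f g))
      (solve 4 (λ a b c d → (a :* b) :* (c :* d) := (a :* c) :* (b :* d)) ≈-refl (f x) (g x) _ _)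

    Π-1 : ∀ (xs : List A) f → (∀ a → a ∈ xs → f a ≈ 1#) → Π[ xs ] f ≈ 1#
    Π-1 []       f h = ≈-refl
    Π-1 (x ∷ xs) f h = ≈-trans (*-cong (h x (here refl)) (Π-1 xs f (λ a → h a ∘ there))) (*-identityˡ _)

    Σ-⟦⟧ : ∀ (xs : List A) b f → Σ[ xs ] (λ a → ⟦ b ⟧ (f a)) ≈ ⟦ b ⟧ (Σ[ xs ] f)
    Σ-⟦⟧ xs true  f = ≈-refl
    Σ-⟦⟧ xs false f = Σ-0 xs _ (λ _ → ≈-refl)

  module _ {A B : Set} where

    Σ-map : ∀ (h : A → B) (xs : List A) f → Σ[ map h xs ] f ≡ Σ[ xs ] (f ∘ h)
    Σ-map h []       f = refl
    Σ-map h (x ∷ xs) f = cong (f (h x) +_) (Σ-map h xs f)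

    Π-map : ∀ (h : A → B) (xs : List A) f → Π[ map h xs ] f ≡ Π[ xs ] (f ∘ h)
    Π-map h []       f = refl
    Π-map h (x ∷ xs) f = cong (f (h x) *_) (Π-map h xs f)

    Σ-concatMap : ∀ (g : A → List B) (xs : List A) f → Σ[ concatMap g xs ] f ≈ Σ[ xs ] (λ a → Σ[ g a ] f)
    Σ-concatMap g []       f = ≈-refl
    Σ-concatMap g (x ∷ xs) f = ≈-trans (Σ-++ (g x) (concatMap g xs) f) (+-cong ≈-refl (Σ-concatMap g xs f))

    Σ-swap : ∀ (xs : List A) (ys : List B) (f : A → B → Carrier) →
             Σ[ xs ] (λ a → Σ[ ys ] (f a)) ≈ Σ[ ys ] (λ b → Σ[ xs ] (λ a → f a b))
    Σ-swap []       ys f = ≈-sym (Σ-0 ys _ (λ _ → ≈-refl))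
    Σ-swap (x ∷ xs) ys f = ≈-trans (+-cong ≈-refl (Σ-swap xs ys f)) (≈-sym (Σ-+ ys (f x) _))

  pow-cong : ∀ {a b} k → a ≈ b → pow R a k ≈ pow R b k
  pow-cong zero    e = ≈-refl
  pow-cong (suc k) e = *-cong e (pow-cong k e)

  pow-+ : ∀ a m k → pow R a (m ℕ.+ k) ≈ pow R a m * pow R a k
  pow-+ a zero    k = ≈-sym (*-identityˡ _)
  pow-+ a (suc m) k = ≈-trans (*-cong ≈-refl (pow-+ a m k)) (≈-sym (*-assoc _ _ _))

  pow-* : ∀ a b k → pow R (a * b) k ≈ pow R a k * pow R b k
  pow-* a b zero    = ≈-sym (*-identityˡ _)
  pow-* a b (suc k) = ≈-trans (*-cong ≈-refl (pow-* a b k))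
    (solve 4 (λ a b c d → (a :* b) :* (c :* d) := (a :* c) :* (b :* d)) ≈-refl a b _ _)

  pow-1# : ∀ k → pow R 1# k ≈ 1#
  pow-1# zero    = ≈-refl
  pow-1# (suc k) = ≈-trans (*-identityˡ _) (pow-1# k)

  Π-pow : ∀ {A : Set} (xs : List A) a (w : A → ℕ) → Π[ xs ] (λ u → pow R a (w u)) ≈ pow R a (foldr ℕ._+_ 0 (map w xs))
  Π-pow []       a w = ≈-refl
  Π-pow (x ∷ xs) a w = ≈-trans (*-cong ≈-refl (Π-pow xs a w)) (≈-sym (pow-+ a (w x) _))

  -x≈-1*x : ∀ x → - x ≈ -1# * x
  -x≈-1*x x = ≈-sym (RingProperties.-1*x≈-x ring x)

  -1*-1 : -1# * -1# ≈ 1#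
  -1*-1 = ≈-trans (≈-sym (-x≈-1*x -1#)) (RingProperties.-‿involutive ring 1#)

  x+-1*x : ∀ x → x + -1# * x ≈ 0#
  x+-1*x x = ≈-trans (+-cong ≈-refl (≈-sym (-x≈-1*x x))) (-‿inverseʳ x)

  Π-sign : ∀ {A : Set} (p : A → Bool) (xs : List A) → Π[ xs ] (λ v → if p v then -1# else 1#) ≈ pow R -1# (countB p xs)
  Π-sign p []       = ≈-refl
  Π-sign p (x ∷ xs) rewrite filterᵇ-∷ p x xs with p x
  ... | true  = *-cong ≈-refl (Π-sign p xs)
  ... | false = ≈-trans (*-identityˡ _) (Π-sign p xs)

  ⟦⟧-cong : ∀ b {x y} → x ≈ y → ⟦ b ⟧ x ≈ ⟦ b ⟧ y
  ⟦⟧-cong true  e = e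
  ⟦⟧-cong false e = ≈-refl

  ⟦⟧-≡ : ∀ {b b′} x → b ≡ b′ → ⟦ b ⟧ x ≈ ⟦ b′ ⟧ x
  ⟦⟧-≡ x refl = ≈-refl

  ⟦false⟧ : ∀ {b} x → ¬ T b → ⟦ b ⟧ x ≈ 0#
  ⟦false⟧ x ¬b rewrite ¬T⇒≡false ¬b = ≈-refl

  ⟦⟧-* : ∀ b x y → ⟦ b ⟧ x * y ≈ ⟦ b ⟧ (x * y)
  ⟦⟧-* true  x y = ≈-refl
  ⟦⟧-* false x y = zeroˡ y

  ⟦⟧-∧ : ∀ a b x → ⟦ a ∧ b ⟧ x ≈ ⟦ a ⟧ (⟦ b ⟧ x)
  ⟦⟧-∧ true  b x = ≈-refl
  ⟦⟧-∧ false b x = ≈-refl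

  module _ {A : Set} (_≟_ : DecidableEquality A) where

    Σ-δ-∉ : ∀ (xs : List A) b (φ : A → Carrier) → ¬ b ∈ xs → Σ[ xs ] (λ a → ⟦ ⌊ a ≟ b ⌋ ⟧ (φ a)) ≈ 0#
    Σ-δ-∉ []       b φ b∉ = ≈-refl
    Σ-δ-∉ (x ∷ xs) b φ b∉ with x ≟ b
    ... | yes refl = ⊥-elim (b∉ (here refl))
    ... | no  _    = ≈-trans (+-identityˡ _) (Σ-δ-∉ xs b φ (b∉ ∘ there))

    Σ-δ : ∀ (xs : List A) b (φ : A → Carrier) → Unique xs → b ∈ xs → Σ[ xs ] (λ a → ⟦ ⌊ a ≟ b ⌋ ⟧ (φ a)) ≈ φ b
    Σ-δ (x ∷ xs) b φ (x∉ AllPairs.∷ uq) (here refl) with x ≟ x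
    ... | yes _  = ≈-trans (+-cong ≈-refl (Σ-δ-∉ xs x φ (λ m → All.lookup x∉ m refl))) (+-identityʳ _)
    ... | no x≢x = ⊥-elim (x≢x refl)
    Σ-δ (x ∷ xs) b φ (x∉ AllPairs.∷ uq) (there b∈) with x ≟ b
    ... | yes refl = ⊥-elim (All.lookup x∉ b∈ refl)
    ... | no  _    = ≈-trans (+-identityˡ _) (Σ-δ xs b φ uq b∈)

    module _ (φ : A → Carrier) (j : A) where

      δ : A → Carrier
      δ u = if ⌊ u ≟ j ⌋ then φ u else 1#

      Π-δ-∉ : ∀ xs → ¬ j ∈ xs → Π[ xs ] δ ≈ 1#
      Π-δ-∉ xs j∉ = Π-1 xs δ δ≈1
        where
        δ≈1 : ∀ u → u ∈ xs → δ u ≈ 1#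
        δ≈1 u u∈ with u ≟ j
        ... | yes refl = ⊥-elim (j∉ u∈)
        ... | no  _    = ≈-refl

      Π-δ : ∀ xs → Unique xs → j ∈ xs → Π[ xs ] δ ≈ φ j
      Π-δ (x ∷ xs) (x∉ AllPairs.∷ uq) (here refl) with x ≟ x
      ... | yes _  = ≈-trans (*-cong ≈-refl (Π-δ-∉ xs (λ m → All.lookup x∉ m refl))) (*-identityʳ _)
      ... | no x≢x = ⊥-elim (x≢x refl)
      Π-δ (x ∷ xs) (x∉ AllPairs.∷ uq) (there j∈) with x ≟ j
      ... | yes refl = ⊥-elim (All.lookup x∉ j∈ refl)
      ... | no  _    = ≈-trans (*-identityˡ _) (Π-δ xs uq j∈)

module _ {Z : Set} where

  snocF : ∀ {n} → (Fin n → Z) → Z → Fin (suc n) → Z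
  snocF {zero}  g a _         = a
  snocF {suc n} g a F.zero    = g F.zero
  snocF {suc n} g a (F.suc i) = snocF (g ∘ F.suc) a i

  snocF-inject₁ : ∀ {n} (g : Fin n → Z) a i → snocF g a (inject₁ i) ≡ g i
  snocF-inject₁ {suc n} g a F.zero    = refl
  snocF-inject₁ {suc n} g a (F.suc i) = snocF-inject₁ (g ∘ F.suc) a i

  snocF-fromℕ : ∀ {n} (g : Fin n → Z) a → snocF g a (fromℕ n) ≡ a
  snocF-fromℕ {zero}  g a = refl
  snocF-fromℕ {suc n} g a = snocF-fromℕ (g ∘ F.suc) a

  snocF-cong : ∀ {n} {g g′ : Fin n → Z} a → (∀ i → g i ≡ g′ i) → ∀ i → snocF g a i ≡ snocF g′ a i
  snocF-cong {zero}  a e i         = refl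
  snocF-cong {suc n} a e F.zero    = e F.zero
  snocF-cong {suc n} a e (F.suc i) = snocF-cong a (e ∘ F.suc) i

assignments : ∀ {K Lab : Set} → List Lab → List K → List (List (K × Lab))
assignments labs []       = [] ∷ []
assignments labs (e ∷ es) = concatMap (λ o → map ((e , o) ∷_) (assignments labs es)) labs

module FunctionSums {c ℓ : Level} (R : CommutativeRing c ℓ) {Z : Set} (zs : List Z) where
  open CommutativeRing R using (Carrier; _≈_; +-identityʳ; reflexive)
  open RingSums R

  Extensional : ∀ {n} → ((Fin n → Z) → Carrier) → Set _
  Extensional {n} F = ∀ κ κ′ → (∀ i → κ i ≡ κ′ i) → F κ ≈ F κ′

  Σ-funs-suc : ∀ k (F : (Fin (suc k) → Z) → Carrier) → Extensional F →
               Σ[ funs zs (suc k) ] F ≈ Σ[ zs ] (λ a → Σ[ funs zs k ] (λ g → F (a ∷ᶠ g)))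
  Σ-funs-suc k F ext = ≈-trans (Σ-concatMap _ zs F) (Σ-cong zs (λ a →
    ≈-trans (reflexive (Σ-map _ (funs zs k) F))
            (Σ-cong (funs zs k) (λ g → ext _ _ (λ { F.zero → refl ; (F.suc i) → refl })))))

  Σ-funs-snoc : ∀ k (F : (Fin (suc k) → Z) → Carrier) → Extensional F →
                Σ[ funs zs (suc k) ] F ≈ Σ[ funs zs k ] (λ g → Σ[ zs ] (λ a → F (snocF g a)))
  Σ-funs-snoc zero F ext = ≈-trans (Σ-funs-suc zero F ext)
    (≈-trans (Σ-cong zs (λ a → ≈-trans (+-identityʳ _) (ext _ _ (λ { F.zero → refl })))) (≈-sym (+-identityʳ _)))
  Σ-funs-snoc (suc k) F ext = begin
    Σ[ funs zs (suc (suc k)) ] F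
      ≈⟨ Σ-funs-suc (suc k) F ext ⟩
    Σ[ zs ] (λ a → Σ[ funs zs (suc k) ] (λ g → F (a ∷ᶠ g)))
      ≈⟨ Σ-cong zs (λ a → Σ-funs-snoc k (λ g → F (a ∷ᶠ g))
                            (λ κ κ′ e → ext _ _ (λ { F.zero → refl ; (F.suc i) → e i }))) ⟩
    Σ[ zs ] (λ a → Σ[ funs zs k ] (λ g → Σ[ zs ] (λ b → F (a ∷ᶠ snocF g b))))
      ≈⟨ Σ-cong zs (λ a → Σ-cong (funs zs k) (λ g → Σ-cong zs (λ b →
           ext _ _ (λ { F.zero → refl ; (F.suc i) → refl })))) ⟩
    Σ[ zs ] (λ a → Σ[ funs zs k ] (λ g → Σ[ zs ] (λ b → F (snocF (a ∷ᶠ g) b))))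
      ≈⟨ ≈-sym (Σ-funs-suc k (λ g → Σ[ zs ] (λ b → F (snocF g b)))
                 (λ κ κ′ e → Σ-cong zs (λ b → ext _ _ (snocF-cong b e)))) ⟩
    Σ[ funs zs (suc k) ] (λ g → Σ[ zs ] (λ b → F (snocF g b))) ∎

  Σ-funs-assignments : ∀ {K : Set} k (E : Fin k → K) (H : List (K × Z) → Carrier) →
    Σ[ funs zs k ] (λ γ → H (tabulate (λ i → (E i , γ i)))) ≈ Σ[ assignments zs (tabulate E) ] H
  Σ-funs-assignments zero    E H = ≈-refl
  Σ-funs-assignments (suc k) E H = begin
    Σ[ funs zs (suc k) ] (λ γ → H (tabulate (λ i → (E i , γ i))))
      ≈⟨ Σ-concatMap _ zs _ ⟩
    Σ[ zs ] (λ a → Σ[ map _ (funs zs k) ] (λ γ → H (tabulate (λ i → (E i , γ i)))))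
      ≈⟨ Σ-cong zs (λ a → reflexive (Σ-map _ (funs zs k) _)) ⟩
    Σ[ zs ] (λ a → Σ[ funs zs k ] (λ g → H ((E F.zero , a) ∷ tabulate (λ i → (E (F.suc i) , g i)))))
      ≈⟨ Σ-cong zs (λ a → Σ-funs-assignments k (E ∘ F.suc) (H ∘ ((E F.zero , a) ∷_))) ⟩
    Σ[ zs ] (λ a → Σ[ assignments zs (tabulate (E ∘ F.suc)) ] (H ∘ ((E F.zero , a) ∷_)))
      ≈⟨ Σ-cong zs (λ a → reflexive (sym (Σ-map _ (assignments zs (tabulate (E ∘ F.suc))) H))) ⟩
    Σ[ zs ] (λ a → Σ[ map ((E F.zero , a) ∷_) (assignments zs (tabulate (E ∘ F.suc))) ] H)
      ≈⟨ ≈-sym (Σ-concatMap _ zs H) ⟩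
    Σ[ assignments zs (tabulate E) ] H ∎

-- Sums over colourings constant on the classes of an equivalence

module Factorisation {c ℓ : Level} (R : CommutativeRing c ℓ) {Z : Set} (_≟Z_ : DecidableEquality Z)
                     (zs : List Z) (zs-unique : Unique zs) (zs-complete : ∀ z → z ∈ zs) where
  open CommutativeRing R using (Carrier; _≈_; _*_; 1#; *-cong; +-identityʳ; *-identityʳ; reflexive)
  open RingSums R
  open FunctionSums R zs

  module Classes {n : ℕ} (_~_ : Fin n → Fin n → Bool) where

    Constant : (Fin n → Z) → Set
    Constant κ = ∀ u v → T (u ~ v) → κ u ≡ κ v

    constant : (Fin n → Z) → Bool
    constant κ = allB (λ u → allB (λ v → not (u ~ v) ∨ ⌊ κ u ≟Z κ v ⌋) (allFin n)) (allFin n)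

    constant⁻ : ∀ κ → T (constant κ) → Constant κ
    constant⁻ κ h u v u~v with T-∨⁻ {not (u ~ v)} (allB⁻ {xs = allFin n} (allB⁻ {xs = allFin n} h (MP.∈-allFin u)) (MP.∈-allFin v))
    ... | inj₁ u≁v = ⊥-elim (T-not⁻ u≁v u~v)
    ... | inj₂ κu≡κv = toWitness κu≡κv

    constant⁺ : ∀ κ → Constant κ → T (constant κ)
    constant⁺ κ h = allB⁺ {xs = allFin n} (λ {u} _ → allB⁺ {xs = allFin n} (λ {v} _ → pair u v))
      where
      pair : ∀ u v → T (not (u ~ v) ∨ ⌊ κ u ≟Z κ v ⌋)
      pair u v with T? (u ~ v)
      ... | yes u~v = T-∨⁺ʳ {not (u ~ v)} (fromWitness (h u v u~v))
      ... | no  u≁v = T-∨⁺ˡ (T-not⁺ u≁v)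

    leader : Fin n → Bool
    leader v = allB (λ u → not ((toℕ u <ᵇ toℕ v) ∧ u ~ v)) (allFin n)

    leader⁻ : ∀ v → T (leader v) → ∀ u → toℕ u ℕ.< toℕ v → ¬ T (u ~ v)
    leader⁻ v h u u<v u~v = T-not⁻ (allB⁻ h (MP.∈-allFin u)) (T-∧⁺ (ℕP.<⇒<ᵇ u<v) u~v)

    leader⁺ : ∀ v → (∀ u → toℕ u ℕ.< toℕ v → ¬ T (u ~ v)) → T (leader v)
    leader⁺ v h = allB⁺ {xs = allFin n} (λ {u} _ → T-not⁺ (λ x →
      let u<v , u~v = T-∧⁻ {toℕ u <ᵇ toℕ v} x in h u (ℕP.<ᵇ⇒< _ _ u<v) u~v))

    class : Fin n → List (Fin n)
    class v = filterᵇ (v ~_) (allFin n)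

  open Classes public

  Σ-constant : ∀ n (_~_ : Fin n → Fin n → Bool) (h : Fin n → Z → Carrier) → Carrier
  Σ-constant n _~_ h = Σ[ funs zs n ] (λ κ → ⟦ constant _~_ κ ⟧ (Π[ allFin n ] (λ v → h v (κ v))))

  Π-classes : ∀ n (_~_ : Fin n → Fin n → Bool) (h : Fin n → Z → Carrier) → Carrier
  Π-classes n _~_ h = Π[ filterᵇ (leader _~_) (allFin n) ] (λ v → Σ[ zs ] (λ z → Π[ class _~_ v ] (λ u → h u z)))

  Factorises : ℕ → Set _
  Factorises n = ∀ (_~_ : Fin n → Fin n → Bool) → IsEquivalence (λ u v → T (u ~ v)) →
                 ∀ h → Σ-constant n _~_ h ≈ Π-classes n _~_ h

  constant-extensional : ∀ {n} (_~_ : Fin n → Fin n → Bool) (h : Fin n → Z → Carrier) →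
                         Extensional (λ κ → ⟦ constant _~_ κ ⟧ (Π[ allFin n ] (λ v → h v (κ v))))
  constant-extensional {n} _~_ h κ κ′ e =
    ≈-trans (⟦⟧-≡ _ constant≡) (⟦⟧-cong (constant _~_ κ′) (Π-cong-∈ (allFin n) (λ v _ → reflexive (cong (h v) (e v)))))
    where
    constant≡ : constant _~_ κ ≡ constant _~_ κ′
    constant≡ = T-⇔⇒≡
      (λ x → constant⁺ _~_ κ′ (λ u v r → trans (sym (e u)) (trans (constant⁻ _~_ κ x u v r) (e v))))
      (λ x → constant⁺ _~_ κ (λ u v r → trans (e u) (trans (constant⁻ _~_ κ′ x u v r) (sym (e v)))))

  Π-singleton-filterᵇ : ∀ {A : Set} (p : A → Bool) x (F : A → Carrier) → Π[ filterᵇ p (x ∷ []) ] F ≈ (if p x then F x else 1#)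
  Π-singleton-filterᵇ p x F rewrite filterᵇ-∷ p x [] with p x
  ... | true  = *-identityʳ _
  ... | false = ≈-refl

  Π-δ-filterᵇ : ∀ {n} φ (j : Fin n) (p : Fin n → Bool) → Π[ filterᵇ p (allFin n) ] (δ _≟F_ (λ _ → φ) j) ≈ (if p j then φ else 1#)
  Π-δ-filterᵇ {n} φ j p with T? (p j)
  ... | yes pj rewrite T⇒≡true pj =
    Π-δ _≟F_ (λ _ → φ) j _ (Unique.filter⁺ (T? ∘ p) (Unique.allFin⁺ n)) (MP.∈-filter⁺ (T? ∘ p) (MP.∈-allFin j) pj)
  ... | no ¬pj rewrite ¬T⇒≡false ¬pj =
    Π-δ-∉ _≟F_ (λ _ → φ) j _ (λ m → ¬pj (proj₂ (MP.∈-filter⁻ (T? ∘ p) {xs = allFin n} m)))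

  module LastVertex (n : ℕ) (_~_ : Fin (suc n) → Fin (suc n) → Bool) (eqv : IsEquivalence (λ u v → T (u ~ v)))
                    (h : Fin (suc n) → Z → Carrier) where
    open IsEquivalence eqv using () renaming (refl to ~-refl; sym to ~-sym; trans to ~-trans)

    last : Fin (suc n)
    last = fromℕ n

    _~′_ : Fin n → Fin n → Bool
    i ~′ j = inject₁ i ~ inject₁ j

    eqv′ : IsEquivalence (λ u v → T (u ~′ v))
    eqv′ = record { refl = ~-refl ; sym = ~-sym ; trans = ~-trans }

    h′ : Fin n → Z → Carrier
    h′ i = h (inject₁ i)

    Πh′ : (Fin n → Z) → Carrier
    Πh′ g = Π[ allFin n ] (λ i → h′ i (g i))

    Σ-constant-snocF : Σ-constant (suc n) _~_ h ≈
                       Σ[ funs zs n ] (λ g → Σ[ zs ] (λ a → ⟦ constant _~_ (snocF g a) ⟧ (Πh′ g * h last a)))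
    Σ-constant-snocF = ≈-trans (Σ-funs-snoc n _ (constant-extensional _~_ h))
      (Σ-cong (funs zs n) (λ g → Σ-cong zs (λ a → ⟦⟧-cong (constant _~_ (snocF g a)) (Π-snocF g a))))
      where
      Π-snocF : ∀ g a → Π[ allFin (suc n) ] (λ v → h v (snocF g a v)) ≈ Πh′ g * h last a
      Π-snocF g a = begin
        Π[ allFin (suc n) ] F                        ≡⟨ cong (λ xs → Π[ xs ] F) (allFin-∷ʳ n) ⟩
        Π[ map inject₁ (allFin n) ++ last ∷ [] ] F   ≈⟨ Π-++ (map inject₁ (allFin n)) (last ∷ []) F ⟩
        Π[ map inject₁ (allFin n) ] F * (F last * 1#) ≈⟨ *-cong (reflexive (Π-map inject₁ (allFin n) F)) (*-identityʳ _) ⟩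
        Π[ allFin n ] (F ∘ inject₁) * F last         ≈⟨ *-cong (Π-cong-∈ (allFin n) (λ i _ → reflexive (cong (h′ i) (snocF-inject₁ g a i))))
                                                               (reflexive (cong (h last) (snocF-fromℕ g a))) ⟩
        Πh′ g * h last a ∎
        where
        F : Fin (suc n) → Carrier
        F v = h v (snocF g a v)

    constant-restrict : ∀ g a → Constant _~_ (snocF g a) → Constant _~′_ g
    constant-restrict g a C i j r = trans (sym (snocF-inject₁ g a i)) (trans (C (inject₁ i) (inject₁ j) r) (snocF-inject₁ g a j))

    leader-inject₁ : ∀ i → leader _~_ (inject₁ i) ≡ leader _~′_ i
    leader-inject₁ i = T-⇔⇒≡
      (λ x → leader⁺ _~′_ i (λ u u<i → leader⁻ _~_ (inject₁ i) x (inject₁ u) (toℕ-inject₁-< u<i)))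
      (λ x → leader⁺ _~_ (inject₁ i) (λ u u<i → earlier u u<i x))
      where
      toℕ-inject₁-< : ∀ {u v : Fin n} → toℕ u ℕ.< toℕ v → toℕ (inject₁ u) ℕ.< toℕ (inject₁ v)
      toℕ-inject₁-< {u} {v} lt rewrite FP.toℕ-inject₁ u | FP.toℕ-inject₁ v = lt
      earlier : ∀ u → toℕ u ℕ.< toℕ (inject₁ i) → T (leader _~′_ i) → ¬ T (u ~ inject₁ i)
      earlier u u<i x with Top.view u
      ... | ‵fromℕ = ⊥-elim (ℕP.<-asym u<i (toℕ-inject₁<toℕ-fromℕ i))
      ... | ‵inject₁ u′ rewrite FP.toℕ-inject₁ u′ | FP.toℕ-inject₁ i = leader⁻ _~′_ i x u′ u<i

    Φ : Fin (suc n) → Carrier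
    Φ v = Σ[ zs ] (λ z → Π[ class _~_ v ] (λ u → h u z))

    Π-classes-split : Π-classes (suc n) _~_ h ≈
                      Π[ filterᵇ (leader _~′_) (allFin n) ] (Φ ∘ inject₁) * (if leader _~_ last then Φ last else 1#)
    Π-classes-split = begin
      Π[ filterᵇ (leader _~_) (allFin (suc n)) ] Φ
        ≡⟨ cong (λ xs → Π[ xs ] Φ) leaders-split ⟩
      Π[ map inject₁ (filterᵇ (leader _~′_) (allFin n)) ++ filterᵇ (leader _~_) (last ∷ []) ] Φ
        ≈⟨ Π-++ (map inject₁ (filterᵇ (leader _~′_) (allFin n))) _ Φ ⟩
      Π[ map inject₁ (filterᵇ (leader _~′_) (allFin n)) ] Φ * Π[ filterᵇ (leader _~_) (last ∷ []) ] Φ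
        ≈⟨ *-cong (reflexive (Π-map inject₁ (filterᵇ (leader _~′_) (allFin n)) Φ)) (Π-singleton-filterᵇ (leader _~_) last Φ) ⟩
      Π[ filterᵇ (leader _~′_) (allFin n) ] (Φ ∘ inject₁) * (if leader _~_ last then Φ last else 1#) ∎
      where
      leaders-split : filterᵇ (leader _~_) (allFin (suc n)) ≡
                      map inject₁ (filterᵇ (leader _~′_) (allFin n)) ++ filterᵇ (leader _~_) (last ∷ [])
      leaders-split =
        trans (cong (filterᵇ (leader _~_)) (allFin-∷ʳ n))
        (trans (LP.filter-++ (T? ∘ leader _~_) (map inject₁ (allFin n)) (last ∷ []))
        (cong (_++ filterᵇ (leader _~_) (last ∷ [])) (trans (filterᵇ-map (leader _~_) inject₁ (allFin n))
        (cong (map inject₁) (LP.filter-≐ (T? ∘ (leader _~_ ∘ inject₁)) (T? ∘ leader _~′_)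
           ((λ {i} → subst T (leader-inject₁ i)) , (λ {i} → subst T (sym (leader-inject₁ i)))) (allFin n))))))

    class-split : ∀ x → class _~_ x ≡ map inject₁ (filterᵇ (λ u → x ~ inject₁ u) (allFin n)) ++ filterᵇ (x ~_) (last ∷ [])
    class-split x = trans (cong (filterᵇ (x ~_)) (allFin-∷ʳ n))
                   (trans (LP.filter-++ (T? ∘ (x ~_)) (map inject₁ (allFin n)) (last ∷ []))
                          (cong (_++ filterᵇ (x ~_) (last ∷ [])) (filterᵇ-map (x ~_) inject₁ (allFin n))))

    Φ-inject₁ : ∀ v → Φ (inject₁ v) ≈ Σ[ zs ] (λ z → Π[ class _~′_ v ] (λ u → h′ u z) * (if inject₁ v ~ last then h last z else 1#))
    Φ-inject₁ v = Σ-cong zs (λ z → begin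
      Π[ class _~_ (inject₁ v) ] (λ u → h u z)
        ≡⟨ cong (λ xs → Π[ xs ] (λ u → h u z)) (class-split (inject₁ v)) ⟩
      Π[ map inject₁ (class _~′_ v) ++ filterᵇ (inject₁ v ~_) (last ∷ []) ] (λ u → h u z)
        ≈⟨ Π-++ (map inject₁ (class _~′_ v)) _ _ ⟩
      Π[ map inject₁ (class _~′_ v) ] (λ u → h u z) * Π[ filterᵇ (inject₁ v ~_) (last ∷ []) ] (λ u → h u z)
        ≈⟨ *-cong (reflexive (Π-map inject₁ (class _~′_ v) _)) (Π-singleton-filterᵇ (inject₁ v ~_) last (λ u → h u z)) ⟩
      Π[ class _~′_ v ] (λ u → h′ u z) * (if inject₁ v ~ last then h last z else 1#) ∎)

    snocF-constant : ∀ g a → Constant _~′_ g → (∀ i → T (inject₁ i ~ last) → g i ≡ a) → Constant _~_ (snocF g a)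
    snocF-constant g a C C-last u v r with Top.view u | Top.view v
    ... | ‵inject₁ i | ‵inject₁ k = trans (snocF-inject₁ g a i) (trans (C i k r) (sym (snocF-inject₁ g a k)))
    ... | ‵inject₁ i | ‵fromℕ     = trans (snocF-inject₁ g a i) (trans (C-last i r) (sym (snocF-fromℕ g a)))
    ... | ‵fromℕ     | ‵inject₁ k = trans (snocF-fromℕ g a) (trans (sym (C-last k (~-sym r))) (sym (snocF-inject₁ g a k)))
    ... | ‵fromℕ     | ‵fromℕ     = refl

    module NewClass (IH : Factorises n) (alone : ∀ i → ¬ T (inject₁ i ~ last)) where

      constant-snocF : ∀ g a → constant _~_ (snocF g a) ≡ constant _~′_ g
      constant-snocF g a = T-⇔⇒≡
        (constant⁺ _~′_ g ∘ constant-restrict g a ∘ constant⁻ _~_ (snocF g a))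
        (λ x → constant⁺ _~_ (snocF g a) (snocF-constant g a (constant⁻ _~′_ g x) (λ i r → ⊥-elim (alone i r))))

      leader-last : leader _~_ last ≡ true
      leader-last = T⇒≡true (leader⁺ _~_ last earlier)
        where
        earlier : ∀ u → toℕ u ℕ.< toℕ last → ¬ T (u ~ last)
        earlier u u<last with Top.view u
        ... | ‵inject₁ i = alone i
        ... | ‵fromℕ     = ⊥-elim (ℕP.<-irrefl refl u<last)

      Π-class-last : ∀ z → Π[ class _~_ last ] (λ u → h u z) ≈ h last z
      Π-class-last z = begin
        Π[ class _~_ last ] (λ u → h u z)
          ≡⟨ cong (λ xs → Π[ xs ] (λ u → h u z)) (class-split last) ⟩
        Π[ map inject₁ (filterᵇ (λ u → last ~ inject₁ u) (allFin n)) ++ filterᵇ (last ~_) (last ∷ []) ] (λ u → h u z)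
          ≡⟨ cong (λ xs → Π[ map inject₁ xs ++ filterᵇ (last ~_) (last ∷ []) ] (λ u → h u z))
                  (LP.filter-none (T? ∘ (λ u → last ~ inject₁ u)) {allFin n} (All.tabulate (λ {i} _ → alone i ∘ ~-sym))) ⟩
        Π[ filterᵇ (last ~_) (last ∷ []) ] (λ u → h u z)
          ≈⟨ Π-singleton-filterᵇ (last ~_) last (λ u → h u z) ⟩
        (if last ~ last then h last z else 1#)
          ≡⟨ cong (λ b → if b then h last z else 1#) (T⇒≡true ~-refl) ⟩
        h last z ∎

      Π-classes-snoc : Π-classes (suc n) _~_ h ≈ Π-classes n _~′_ h′ * Σ[ zs ] (h last)
      Π-classes-snoc = ≈-trans Π-classes-split (*-cong
        (Π-cong-∈ (filterᵇ (leader _~′_) (allFin n)) (λ v _ → ≈-trans (Φ-inject₁ v) (Σ-cong zs (λ z →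
          ≈-trans (*-cong ≈-refl (reflexive (cong (λ b → if b then h last z else 1#) (¬T⇒≡false (alone v)))))
                  (*-identityʳ _)))))
        (≈-trans (reflexive (cong (λ b → if b then Φ last else 1#) leader-last)) (Σ-cong zs Π-class-last)))

      factorises : Σ-constant (suc n) _~_ h ≈ Π-classes (suc n) _~_ h
      factorises = begin
        Σ-constant (suc n) _~_ h
          ≈⟨ Σ-constant-snocF ⟩
        Σ[ funs zs n ] (λ g → Σ[ zs ] (λ a → ⟦ constant _~_ (snocF g a) ⟧ (Πh′ g * h last a)))
          ≈⟨ Σ-cong (funs zs n) (λ g → Σ-cong zs (λ a →
               ≈-trans (⟦⟧-≡ _ (constant-snocF g a)) (≈-sym (⟦⟧-* (constant _~′_ g) (Πh′ g) (h last a))))) ⟩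
        Σ[ funs zs n ] (λ g → Σ[ zs ] (λ a → ⟦ constant _~′_ g ⟧ (Πh′ g) * h last a))
          ≈⟨ Σ-cong (funs zs n) (λ g → ≈-sym (*-Σ zs (⟦ constant _~′_ g ⟧ (Πh′ g)) (h last))) ⟩
        Σ[ funs zs n ] (λ g → ⟦ constant _~′_ g ⟧ (Πh′ g) * Σ[ zs ] (h last))
          ≈⟨ ≈-sym (Σ-* (funs zs n) (Σ[ zs ] (h last)) _) ⟩
        Σ-constant n _~′_ h′ * Σ[ zs ] (h last)
          ≈⟨ *-cong (IH _~′_ eqv′ h′) ≈-refl ⟩
        Π-classes n _~′_ h′ * Σ[ zs ] (h last)
          ≈⟨ ≈-sym Π-classes-snoc ⟩
        Π-classes (suc n) _~_ h ∎

    module JoinsClass (IH : Factorises n) (j : Fin n) (j~last : T (inject₁ j ~ last)) where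

      constant-snocF : ∀ g a → constant _~_ (snocF g a) ≡ constant _~′_ g ∧ ⌊ a ≟Z g j ⌋
      constant-snocF g a = T-⇔⇒≡
        (λ x → let C = constant⁻ _~_ (snocF g a) x in
           T-∧⁺ (constant⁺ _~′_ g (constant-restrict g a C))
                (fromWitness (trans (sym (snocF-fromℕ g a)) (trans (sym (C (inject₁ j) last j~last)) (snocF-inject₁ g a j)))))
        (λ x → let x₁ , x₂ = T-∧⁻ {constant _~′_ g} x
                   C = constant⁻ _~′_ g x₁ in
           constant⁺ _~_ (snocF g a) (snocF-constant g a C
             (λ i r → trans (C i j (~-trans r (~-sym j~last))) (sym (toWitness x₂)))))

      leader-last : leader _~_ last ≡ false
      leader-last = ¬T⇒≡false (λ x → leader⁻ _~_ last x (inject₁ j) (toℕ-inject₁<toℕ-fromℕ j) j~last)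

      -- the last vertex is absorbed into the class of j
      h″ : Fin n → Z → Carrier
      h″ i z = h′ i z * δ _≟F_ (λ _ → h last z) j i

      Π-classes-snoc : Π-classes (suc n) _~_ h ≈ Π-classes n _~′_ h″
      Π-classes-snoc = ≈-trans Π-classes-split
        (≈-trans (*-cong ≈-refl (reflexive (cong (λ b → if b then Φ last else 1#) leader-last)))
        (≈-trans (*-identityʳ _)
        (Π-cong-∈ (filterᵇ (leader _~′_) (allFin n)) (λ v _ → ≈-trans (Φ-inject₁ v) (Σ-cong zs (λ z → ≈-sym (begin
          Π[ class _~′_ v ] (λ u → h″ u z)
            ≈⟨ Π-* (class _~′_ v) _ _ ⟩
          Π[ class _~′_ v ] (λ u → h′ u z) * Π[ class _~′_ v ] (δ _≟F_ (λ _ → h last z) j)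
            ≈⟨ *-cong ≈-refl (Π-δ-filterᵇ (h last z) j (v ~′_)) ⟩
          Π[ class _~′_ v ] (λ u → h′ u z) * (if v ~′ j then h last z else 1#)
            ≡⟨ cong (λ b → Π[ class _~′_ v ] (λ u → h′ u z) * (if b then h last z else 1#))
                    (T-⇔⇒≡ (λ r → ~-trans r j~last) (λ r → ~-trans r (~-sym j~last))) ⟩
          Π[ class _~′_ v ] (λ u → h′ u z) * (if inject₁ v ~ last then h last z else 1#) ∎)))))))

      factorises : Σ-constant (suc n) _~_ h ≈ Π-classes (suc n) _~_ h
      factorises = begin
        Σ-constant (suc n) _~_ h
          ≈⟨ Σ-constant-snocF ⟩
        Σ[ funs zs n ] (λ g → Σ[ zs ] (λ a → ⟦ constant _~_ (snocF g a) ⟧ (Πh′ g * h last a)))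
          ≈⟨ Σ-cong (funs zs n) (λ g → Σ-cong zs (λ a →
               ≈-trans (⟦⟧-≡ _ (constant-snocF g a)) (⟦⟧-∧ (constant _~′_ g) _ _))) ⟩
        Σ[ funs zs n ] (λ g → Σ[ zs ] (λ a → ⟦ constant _~′_ g ⟧ (⟦ ⌊ a ≟Z g j ⌋ ⟧ (Πh′ g * h last a))))
          ≈⟨ Σ-cong (funs zs n) (λ g → Σ-⟦⟧ zs (constant _~′_ g) _) ⟩
        Σ[ funs zs n ] (λ g → ⟦ constant _~′_ g ⟧ (Σ[ zs ] (λ a → ⟦ ⌊ a ≟Z g j ⌋ ⟧ (Πh′ g * h last a))))
          ≈⟨ Σ-cong (funs zs n) (λ g → ⟦⟧-cong (constant _~′_ g)
               (Σ-δ _≟Z_ zs (g j) (λ a → Πh′ g * h last a) zs-unique (zs-complete (g j)))) ⟩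
        Σ[ funs zs n ] (λ g → ⟦ constant _~′_ g ⟧ (Πh′ g * h last (g j)))
          ≈⟨ Σ-cong (funs zs n) (λ g → ⟦⟧-cong (constant _~′_ g)
               (≈-sym (≈-trans (Π-* (allFin n) _ _)
                 (*-cong ≈-refl (Π-δ _≟F_ (λ i → h last (g i)) j (allFin n) (Unique.allFin⁺ n) (MP.∈-allFin j)))))) ⟩
        Σ-constant n _~′_ (λ i z → h″ i z)
          ≈⟨ IH _~′_ eqv′ h″ ⟩
        Π-classes n _~′_ h″
          ≈⟨ ≈-sym Π-classes-snoc ⟩
        Π-classes (suc n) _~_ h ∎

  factorise : ∀ n → Factorises n
  factorise zero    _~_ eqv h = +-identityʳ _
  factorise (suc n) _~_ eqv h with T? (anyB (λ i → inject₁ i ~ fromℕ n) (allFin n))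
  ... | yes joins = let j , _ , j~last = anyB⁻ {xs = allFin n} joins in
                    LastVertex.JoinsClass.factorises n _~_ eqv h (factorise n) j j~last
  ... | no  alone = LastVertex.NewClass.factorises n _~_ eqv h (factorise n)
                      (λ i r → alone (anyB⁺ {xs = allFin n} (MP.∈-allFin i) r))

-- Counting components

module Components (n : ℕ) (p : Fin n → Bool) where
  open Walks n

  -- components p A counts the vertices v with isLeader A v
  isLeader : List Arc → Fin n → Bool
  isLeader A v = p v ∧ allB (λ u → not (p u ∧ (toℕ u <ᵇ toℕ v) ∧ reach A n u v)) (allFin n)

  isLeader⁻ : ∀ {A v} → T (isLeader A v) → T (p v) × (∀ u → T (p u) → toℕ u ℕ.< toℕ v → ¬ Reach A u v)
  isLeader⁻ {A} {v} h = let pv , rest = T-∧⁻ {p v} h in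
    pv , (λ u pu u<v r → T-not⁻ (allB⁻ {xs = allFin n} rest (MP.∈-allFin u))
                                (T-∧⁺ {p u} pu (T-∧⁺ {toℕ u <ᵇ toℕ v} (ℕP.<⇒<ᵇ u<v) r)))

  isLeader⁺ : ∀ {A v} → T (p v) → (∀ u → T (p u) → toℕ u ℕ.< toℕ v → ¬ Reach A u v) → T (isLeader A v)
  isLeader⁺ {A} {v} pv h = T-∧⁺ {p v} pv (allB⁺ {xs = allFin n} (λ {u} _ → T-not⁺ (λ x →
    let pu , rest = T-∧⁻ {p u} x
        u<v , r = T-∧⁻ {toℕ u <ᵇ toℕ v} rest
    in h u pu (ℕP.<ᵇ⇒< _ _ u<v) r)))

  components-reach : ∀ {A B} → (∀ u v → reach A n u v ≡ reach B n u v) → components p A ≡ components p B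
  components-reach e = countB-cong (allFin n) (λ v _ → cong (p v ∧_) (allB-cong (allFin n) (λ u _ →
    cong (λ r → not (p u ∧ (toℕ u <ᵇ toℕ v) ∧ r)) (e u v))))

  components-≐ : ∀ {A B} → A ⊆ B → B ⊆ A → components p A ≡ components p B
  components-≐ A⊆B B⊆A = components-reach (reach-≐ A⊆B B⊆A)

  Least : (Fin n → Bool) → Set
  Least P = ∃ λ u → T (P u) × (∀ u′ → toℕ u′ ℕ.< toℕ u → ¬ T (P u′))

  least : ∀ P v → T (P v) → Least P
  least P v Pv = descend (suc (toℕ v)) v (ℕP.n<1+n _) Pv
    where
    descend : ∀ k v → toℕ v ℕ.< k → T (P v) → Least P
    descend zero    v ()     Pv
    descend (suc k) v (ℕ.s≤s v≤k) Pv with T? (anyB (λ u → (toℕ u <ᵇ toℕ v) ∧ P u) (allFin n))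
    ... | yes smaller = let u , _ , r = anyB⁻ {xs = allFin n} smaller
                            u<v , Pu = T-∧⁻ {toℕ u <ᵇ toℕ v} r
                        in descend k u (ℕP.<-≤-trans (ℕP.<ᵇ⇒< _ _ u<v) v≤k) Pu
    ... | no  none    = v , Pv , (λ u u<v Pu → none (anyB⁺ {xs = allFin n} (MP.∈-allFin u) (T-∧⁺ {toℕ u <ᵇ toℕ v} (ℕP.<⇒<ᵇ u<v) Pu)))

  module _ (A : List Arc) (A-sym : Symmetric {A}) (A-inside : ∀ {x} → x ∈ A → T (p (proj₁ x)) × T (p (proj₂ x))) where

    Reach-inside : ∀ {u v} → Reach A u v → T (p v) → T (p u)
    Reach-inside {u} {v} r pv = S.[ (λ { refl → pv }) , proj₁ ] (walk-preserves _∼_ (inj₁ refl) ∼-trans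
                                       (inj₂ ∘ A-inside) (Reach⇒Walk r))
      where
      _∼_ : Fin n → Fin n → Set
      u ∼ v = u ≡ v ⊎ (T (p u) × T (p v))
      ∼-trans : Transitive _∼_
      ∼-trans (inj₁ refl) r′          = r′
      ∼-trans (inj₂ r)    (inj₁ refl) = inj₂ r
      ∼-trans (inj₂ (pu , _)) (inj₂ (_ , pw)) = inj₂ (pu , pw)

    module LeaderOf (x : Fin n) (px : T (p x)) where

      minimal : Least (λ u → reach A n u x)
      minimal = least _ x (Reach-refl x)

      leader : Fin n
      leader = proj₁ minimal

      leader⇝x : Reach A leader x
      leader⇝x = proj₁ (proj₂ minimal)

      leader-≤ : ∀ {u} → Reach A u x → ¬ toℕ u ℕ.< toℕ leader
      leader-≤ r u<ℓ = proj₂ (proj₂ minimal) _ u<ℓ r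

      leader-isLeader : T (isLeader A leader)
      leader-isLeader = isLeader⁺ (Reach-inside leader⇝x px) (λ u _ u<ℓ r → leader-≤ (Reach-trans r leader⇝x) u<ℓ)

      leader-unique : ∀ {v} → T (isLeader A v) → Reach A x v → v ≡ leader
      leader-unique {v} v-leader r with ℕP.<-cmp (toℕ leader) (toℕ v)
      ... | tri< ℓ<v _ _ = ⊥-elim (proj₂ (isLeader⁻ v-leader) leader (Reach-inside leader⇝x px) ℓ<v (Reach-trans leader⇝x r))
      ... | tri≈ _ ℓ≡v _ = sym (FP.toℕ-injective ℓ≡v)
      ... | tri> _ _ v<ℓ = ⊥-elim (leader-≤ (Reach-sym A-sym r) v<ℓ)

    -- joining x to y kills the larger of their two leaders and nothing else
    module Join (x y : Fin n) (px : T (p x)) (py : T (p y)) where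
      module X = LeaderOf x px
      module Y = LeaderOf y py

      A⁺ : List Arc
      A⁺ = both (x , y) ++ A

      A⊆A⁺ : A ⊆ A⁺
      A⊆A⁺ = there ∘ there

      leaders-unchanged : toℕ X.leader ℕ.< toℕ Y.leader → ∀ v → v ≢ Y.leader → isLeader A v ≡ isLeader A⁺ v
      leaders-unchanged ℓx<ℓy v v≢ℓy = T-⇔⇒≡
        (λ h → isLeader⁺ (proj₁ (isLeader⁻ h)) (no-reach h))
        (λ h → isLeader⁺ (proj₁ (isLeader⁻ h)) (λ u pu u<v r → proj₂ (isLeader⁻ h) u pu u<v (Reach-⊆ A⊆A⁺ r)))
        where
        no-reach : T (isLeader A v) → ∀ u → T (p u) → toℕ u ℕ.< toℕ v → ¬ Reach A⁺ u v
        no-reach h u pu u<v r = via-split (Reach⇒Walk r)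
          where
          through : ∀ {s t} → s ∈ x ∷ y ∷ [] → t ∈ x ∷ y ∷ [] → Walk A u s → Walk A t v → ⊥
          through (here refl)         (here refl)         w₁ w₂ = proj₂ (isLeader⁻ h) u pu u<v (Walk⇒Reach (w₁ ++ᵂ w₂))
          through (there (here refl)) (there (here refl)) w₁ w₂ = proj₂ (isLeader⁻ h) u pu u<v (Walk⇒Reach (w₁ ++ᵂ w₂))
          through _                   (there (here refl)) w₁ w₂ = v≢ℓy (Y.leader-unique h (Walk⇒Reach w₂))
          through (there (here refl)) (here refl)         w₁ w₂ = Y.leader-≤ (Walk⇒Reach w₁)
            (ℕP.<-trans u<v (subst (λ z → toℕ z ℕ.< toℕ Y.leader) (sym (X.leader-unique h (Walk⇒Reach w₂))) ℓx<ℓy))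

          via-split : Walk A⁺ u v → ⊥
          via-split w with split-first (both (x , y)) w
          ... | inj₁ w₀ = proj₂ (isLeader⁻ h) u pu u<v (Walk⇒Reach w₀)
          ... | inj₂ (e , e∈ , w₁ , rest) with split-last (both (x , y)) rest
          ...   | inj₁ w₂                  = through (proj₁ (both-endpoints e∈)) (proj₂ (both-endpoints e∈)) w₁ w₂
          ...   | inj₂ (e′ , e′∈ , _ , w₂) = through (proj₁ (both-endpoints e∈)) (proj₂ (both-endpoints e′∈)) w₁ w₂

      count-drops : toℕ X.leader ℕ.< toℕ Y.leader → components p A ≡ suc (components p A⁺)
      count-drops ℓx<ℓy = countB-≡suc (isLeader A) (isLeader A⁺) (allFin n) Y.leader (Unique.allFin⁺ n) (MP.∈-allFin _)
                            Y.leader-isLeader ℓy-demoted (λ v _ → leaders-unchanged ℓx<ℓy v)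
        where
        ℓy-demoted : ¬ T (isLeader A⁺ Y.leader)
        ℓy-demoted h = proj₂ (isLeader⁻ h) X.leader (Reach-inside X.leader⇝x px) ℓx<ℓy
          (Reach-trans (Reach-⊆ A⊆A⁺ X.leader⇝x)
          (Reach-trans (Walk⇒Reach (arc (here refl))) (Reach-⊆ A⊆A⁺ (Reach-sym A-sym Y.leader⇝x))))

    components-join : ∀ a b → T (p a) → T (p b) → ¬ Reach A a b → components p A ≡ suc (components p (both (a , b) ++ A))
    components-join a b pa pb a⇝̸b with ℕP.<-cmp (toℕ (LeaderOf.leader a pa)) (toℕ (LeaderOf.leader b pb))
    ... | tri< ℓa<ℓb _ _ = Join.count-drops a b pa pb ℓa<ℓb
    ... | tri≈ _ ℓa≡ℓb _ = ⊥-elim (a⇝̸b (Reach-trans (Reach-sym A-sym (LeaderOf.leader⇝x a pa))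
                             (subst (λ z → Reach A z b) (sym (FP.toℕ-injective ℓa≡ℓb)) (LeaderOf.leader⇝x b pb))))
    ... | tri> _ _ ℓb<ℓa = trans (Join.count-drops b a pb pa ℓb<ℓa) (cong suc (components-≐ swap swap))
      where
      swap : ∀ {a′ b′} → both (a′ , b′) ++ A ⊆ both (b′ , a′) ++ A
      swap (here refl)         = there (here refl)
      swap (there (here refl)) = here refl
      swap (there (there m))   = there (there m)

    components-connected : ∀ a b → Reach A a b → components p (both (a , b) ++ A) ≡ components p A
    components-connected a b r = components-reach (λ u v →
      T-⇔⇒≡ (Walk⇒Reach ∘ replace-arcs (both (a , b)) shortcut ∘ Reach⇒Walk) (Reach-⊆ (there ∘ there)))
      where
      shortcut : ∀ {x} → x ∈ both (a , b) → Walk A (proj₁ x) (proj₂ x)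
      shortcut (here refl)         = Reach⇒Walk r
      shortcut (there (here refl)) = Reach⇒Walk (Reach-sym A-sym r)

-- Plethysm of power sums

module _ (N : ℕ) where

  enumVar-complete : ∀ (f : Expr) (z : Var N f) → z ∈ enumVar N f
  enumVar-complete 𝟙        tt       = here refl
  enumVar-complete (q j)    tt       = here refl
  enumVar-complete (𝐱ₙ k)   i        = MP.∈-allFin i
  enumVar-complete 𝐱        i        = MP.∈-allFin i
  enumVar-complete (f ⊕ g)  (inj₁ z) = MP.∈-++⁺ˡ (MP.∈-map⁺ inj₁ (enumVar-complete f z))
  enumVar-complete (f ⊕ g)  (inj₂ z) = MP.∈-++⁺ʳ (map inj₁ (enumVar N f)) (MP.∈-map⁺ inj₂ (enumVar-complete g z))
  enumVar-complete (⊖ f)    z        = enumVar-complete f z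
  enumVar-complete (ε f)    z        = enumVar-complete f z
  enumVar-complete (f ⊗ g)  (z , y)  = ∈-concatMap⁺-∃ (λ z → map (z ,_) (enumVar N g)) (enumVar-complete f z)
                                         (MP.∈-map⁺ (z ,_) (enumVar-complete g y))

  enumVar-unique : ∀ (f : Expr) → Unique (enumVar N f)
  enumVar-unique 𝟙       = All.[] AllPairs.∷ AllPairs.[]
  enumVar-unique (q j)   = All.[] AllPairs.∷ AllPairs.[]
  enumVar-unique (𝐱ₙ k)  = Unique.allFin⁺ k
  enumVar-unique 𝐱       = Unique.allFin⁺ N
  enumVar-unique (f ⊕ g) = Unique.++⁺ (Unique.map⁺ (λ { refl → refl }) (enumVar-unique f))
                                      (Unique.map⁺ (λ { refl → refl }) (enumVar-unique g)) disjoint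
    where
    disjoint : ∀ {z} → z ∈ map inj₁ (enumVar N f) × z ∈ map inj₂ (enumVar N g) → ⊥
    disjoint (z∈₁ , z∈₂) with MP.∈-map⁻ inj₁ z∈₁ | MP.∈-map⁻ inj₂ z∈₂
    ... | _ , _ , refl | _ , _ , ()
  enumVar-unique (⊖ f)   = enumVar-unique f
  enumVar-unique (ε f)   = enumVar-unique f
  enumVar-unique (f ⊗ g) = subst Unique (sym (concatMap≡cartesianProduct (enumVar N f)))
                                 (Unique.cartesianProduct⁺ (enumVar-unique f) (enumVar-unique g))
    where
    concatMap≡cartesianProduct : ∀ xs → concatMap (λ z → map (z ,_) (enumVar N g)) xs ≡ L.cartesianProduct xs (enumVar N g)
    concatMap≡cartesianProduct []       = refl
    concatMap≡cartesianProduct (x ∷ xs) = cong (map (x ,_) (enumVar N g) ++_) (concatMap≡cartesianProduct xs)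

module PowerSums {c ℓ : Level} (R : CommutativeRing c ℓ) (N : ℕ)
                 (qv : ℕ → CommutativeRing.Carrier R) (xv : Fin N → CommutativeRing.Carrier R) where
  open CommutativeRing R using (Carrier; _≈_; _+_; _*_; -_; 1#; +-cong; *-cong; -‿cong; +-identityʳ;
    *-identityˡ; *-identityʳ; *-assoc; reflexive)
  open RingSums R

  sgnR : ∀ (f : Expr) → Var N f → Carrier
  sgnR f z = if sgn f z then 1# else -1#

  pPleth-expansion : ∀ k (f : Expr) → pPleth R qv xv k f ≈ Σ[ enumVar N f ] (λ z → sgnR f z * pow R (val R qv xv f z) k)
  pPleth-expansion k 𝟙      = ≈-sym (≈-trans (+-identityʳ _) (≈-trans (*-identityˡ _) (pow-1# k)))
  pPleth-expansion k (q j)  = ≈-sym (≈-trans (+-identityʳ _) (*-identityˡ _))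
  pPleth-expansion k (𝐱ₙ m) = Σ-cong (allFin m) (λ i → ≈-sym (*-identityˡ _))
  pPleth-expansion k 𝐱      = Σ-cong (allFin N) (λ i → ≈-sym (*-identityˡ _))
  pPleth-expansion k (f ⊕ g) = ≈-sym (begin
    Σ[ map inj₁ (enumVar N f) ++ map inj₂ (enumVar N g) ] term
      ≈⟨ Σ-++ (map inj₁ (enumVar N f)) _ term ⟩
    Σ[ map inj₁ (enumVar N f) ] term + Σ[ map inj₂ (enumVar N g) ] term
      ≡⟨ cong₂ _+_ (Σ-map inj₁ (enumVar N f) term) (Σ-map inj₂ (enumVar N g) term) ⟩
    Σ[ enumVar N f ] (term ∘ inj₁) + Σ[ enumVar N g ] (term ∘ inj₂)
      ≈⟨ +-cong (≈-sym (pPleth-expansion k f)) (≈-sym (pPleth-expansion k g)) ⟩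
    pPleth R qv xv k f + pPleth R qv xv k g ∎)
    where
    term : Var N (f ⊕ g) → Carrier
    term z = sgnR (f ⊕ g) z * pow R (val R qv xv (f ⊕ g) z) k
  pPleth-expansion k (⊖ f) = ≈-trans (-‿cong (pPleth-expansion k f))
    (≈-trans (-‿Σ (enumVar N f) _) (Σ-cong (enumVar N f) flip-sign))
    where
    flip-sign : ∀ z → - (sgnR f z * pow R (val R qv xv f z) k) ≈ sgnR (⊖ f) z * pow R (val R qv xv f z) k
    flip-sign z with sgn f z
    ... | true  = ≈-trans (-x≈-1*x _) (*-cong ≈-refl (*-identityˡ _))
    ... | false = ≈-trans (-x≈-1*x _) (≈-trans (≈-sym (*-assoc _ _ _)) (*-cong -1*-1 ≈-refl))
  pPleth-expansion k (ε f) = ≈-trans (*-cong ≈-refl (pPleth-expansion k f))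
    (≈-trans (*-Σ (enumVar N f) _ _) (Σ-cong (enumVar N f) negate-variable))
    where
    negate-variable : ∀ z → pow R -1# k * (sgnR f z * pow R (val R qv xv f z) k) ≈ sgnR f z * pow R (- val R qv xv f z) k
    negate-variable z = ≈-trans (solve 3 (λ a b c → a :* (b :* c) := b :* (a :* c)) ≈-refl (pow R -1# k) (sgnR f z) _)
      (*-cong ≈-refl (≈-sym (≈-trans (pow-cong k (-x≈-1*x _)) (pow-* -1# _ k))))
  pPleth-expansion k (f ⊗ g) = begin
    pPleth R qv xv k f * pPleth R qv xv k g
      ≈⟨ *-cong (pPleth-expansion k f) (pPleth-expansion k g) ⟩
    Σ[ enumVar N f ] termf * Σ[ enumVar N g ] termg
      ≈⟨ Σ-* (enumVar N f) _ termf ⟩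
    Σ[ enumVar N f ] (λ z → termf z * Σ[ enumVar N g ] termg)
      ≈⟨ Σ-cong (enumVar N f) (λ z → *-Σ (enumVar N g) (termf z) termg) ⟩
    Σ[ enumVar N f ] (λ z → Σ[ enumVar N g ] (λ y → termf z * termg y))
      ≈⟨ Σ-cong (enumVar N f) (λ z → Σ-cong (enumVar N g) (product-term z)) ⟩
    Σ[ enumVar N f ] (λ z → Σ[ enumVar N g ] (λ y → term (z , y)))
      ≈⟨ Σ-cong (enumVar N f) (λ z → reflexive (sym (Σ-map (z ,_) (enumVar N g) term))) ⟩
    Σ[ enumVar N f ] (λ z → Σ[ map (z ,_) (enumVar N g) ] term)
      ≈⟨ ≈-sym (Σ-concatMap (λ z → map (z ,_) (enumVar N g)) (enumVar N f) term) ⟩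
    Σ[ enumVar N (f ⊗ g) ] term ∎
    where
    termf : Var N f → Carrier
    termf z = sgnR f z * pow R (val R qv xv f z) k
    termg : Var N g → Carrier
    termg y = sgnR g y * pow R (val R qv xv g y) k
    term : Var N (f ⊗ g) → Carrier
    term zy = sgnR (f ⊗ g) zy * pow R (val R qv xv (f ⊗ g) zy) k
    sgnR-⊗ : ∀ z y → sgnR (f ⊗ g) (z , y) ≈ sgnR f z * sgnR g y
    sgnR-⊗ z y with sgn f z | sgn g y
    ... | true  | true  = ≈-sym (*-identityˡ _)
    ... | true  | false = ≈-sym (*-identityˡ _)
    ... | false | true  = ≈-sym (*-identityʳ _)
    ... | false | false = ≈-sym -1*-1
    product-term : ∀ z y → termf z * termg y ≈ term (z , y)
    product-term z y = ≈-sym (≈-trans (*-cong (sgnR-⊗ z y) (pow-* _ _ k))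
      (solve 4 (λ a b c d → (a :* b) :* (c :* d) := (a :* c) :* (b :* d)) ≈-refl _ _ _ _))

-- Colourings and compatible biorientations

compatibleTri : ∀ {a₁ a₂ a₃} {A : Set a₁} {B : Set a₂} {C : Set a₃} → Tri A B C → Bool → Ori → Bool
compatibleTri (tri< _ _ _) _ ⟶ = true
compatibleTri (tri< _ _ _) _ ⟵ = false
compatibleTri (tri< _ _ _) _ ⟷ = false
compatibleTri (tri> _ _ _) _ ⟶ = false
compatibleTri (tri> _ _ _) _ ⟵ = true
compatibleTri (tri> _ _ _) _ ⟷ = false
compatibleTri (tri≈ _ _ _) s o = if s then isBi o else true

module Expansions {c ℓ ℓ′ : Level} (R : CommutativeRing c ℓ) (G : Graph) (w : Fin (Graph.nV G) → ℕ) (f : Expr) (N : ℕ)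
  (_<_ : Rel (Var N f) ℓ′) (ord : IsStrictTotalOrder _≡_ _<_) (t : CommutativeRing.Carrier R)
  (qv : ℕ → CommutativeRing.Carrier R) (xv : Fin N → CommutativeRing.Carrier R) where

  open Graph G
  open CommutativeRing R using (Carrier; _≈_; _+_; _*_; 0#; 1#; +-cong; *-cong; +-identityʳ; +-identityˡ;
    *-identityˡ; *-identityʳ; *-assoc; zeroʳ; reflexive)
  open RingSums R
  open Walks nV
  open IsStrictTotalOrder ord using (compare; irrefl; isStrictPartialOrder; <-respʳ-≈) renaming (trans to <-trans; _≟_ to _≟C_)
  open NonStrict _≡_ _<_ using () renaming (_≤_ to _≼_)

  ≼-isPartialOrder : IsPartialOrder _≡_ _≼_
  ≼-isPartialOrder = NonStrict.isPartialOrder _≡_ _<_ isStrictPartialOrder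
  open IsPartialOrder ≼-isPartialOrder using () renaming (refl to ≼-refl; trans to ≼-trans; antisym to ≼-antisym)

  <⇒⋡ : ∀ {x y} → x < y → ¬ y ≼ x
  <⇒⋡ x<y y≼x = irrefl refl (NonStrict.<-≤-trans _≡_ _<_ <-trans <-respʳ-≈ x<y y≼x)

  Colour : Set
  Colour = Var N f

  colours : List Colour
  colours = enumVar N f

  Colouring : Set
  Colouring = Fin nV → Colour

  negativeColour : Colour → Bool
  negativeColour z = not (sgn f z)

  compatible : Colouring → Arc → Ori → Bool
  compatible κ (a , b) o = compatibleTri (compare (κ a) (κ b)) (sgn f (κ a)) o

  Oriented : Set
  Oriented = List (Arc × Ori)

  arcsOfᴼ : Arc × Ori → List Arc
  arcsOfᴼ (e , o) = arcsOf G o e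

  singleArcsOfᴼ : Arc × Ori → List Arc
  singleArcsOfᴼ (e , o) = singleArcsOf G o e

  bidirectedOfᴼ : Arc × Ori → List Arc
  bidirectedOfᴼ (e , o) = if isBi o then e ∷ [] else []

  arcsᴼ : Oriented → List Arc
  arcsᴼ = concatMap arcsOfᴼ

  singleArcsᴼ : Oriented → List Arc
  singleArcsᴼ = concatMap singleArcsOfᴼ

  bidirectedᴼ : Oriented → List Arc
  bidirectedᴼ = concatMap bidirectedOfᴼ

  #bidirected : Oriented → ℕ
  #bidirected = countB (isBi ∘ proj₂)

  bothL : List Arc → List Arc
  bothL = concatMap both

  noCycleThrough : List Arc → List Arc → Bool
  noCycleThrough A S = allB (λ (a , b) → not (reach A nV b a)) S

  acyclicᴼ : List Arc → Oriented → Bool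
  acyclicᴼ P eo = noCycleThrough (bothL P ++ arcsᴼ eo) (singleArcsᴼ eo)

  module _ (κ : Colouring) where

    negative : Fin nV → Bool
    negative v = negativeColour (κ v)

    monochromatic : List Arc → Bool
    monochromatic = allB (λ (a , b) → ⌊ κ a ≟C κ b ⌋)

    negativeBoth : Arc → List Arc
    negativeBoth (a , b) = if negative a ∧ negative b then both (a , b) else []

    negativeArcs : List Arc → List Arc
    negativeArcs = concatMap negativeBoth

    negativeComponents : List Arc → ℕ
    negativeComponents X = components negative (negativeArcs X)

    sign : List Arc → Carrier
    sign X = ⟦ monochromatic X ⟧ (pow R -1# (negativeComponents X))

    -- subsetSum es P = Σ over S ⊆ es of t^|S| · sign (S ++ P)
    subsetSum : List Arc → List Arc → Carrier
    subsetSum []       P = sign P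
    subsetSum (e ∷ es) P = subsetSum es P + t * subsetSum es (e ∷ P)

    compatibleᴼ : Oriented → Bool
    compatibleᴼ = allB (λ (e , o) → compatible κ e o)

    -- the edges of P are contracted: bidirected, and required to be monochromatic
    orientationValid : List Arc → Oriented → Bool
    orientationValid P eo = monochromatic P ∧ (acyclicᴼ P eo ∧ compatibleᴼ eo)

    orientationWeight : List Arc → Oriented → Carrier
    orientationWeight P eo = pow R (1# + t) (#bidirected eo) * pow R -1# (negativeComponents (P ++ bidirectedᴼ eo))

    orientationTerm : List Arc → Oriented → Carrier
    orientationTerm P eo = ⟦ orientationValid P eo ⟧ (orientationWeight P eo)

    orientationSum : List Arc → List Arc → Carrier
    orientationSum es P = Σ[ assignments allOri es ] (orientationTerm P)

  noCycleThrough-⊆ : ∀ {A A′ S S′} → A ⊆ A′ → S ⊆ S′ → T (noCycleThrough A′ S′) → T (noCycleThrough A S)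
  noCycleThrough-⊆ {S = S} {S′} A⊆A′ S⊆S′ h =
    allB⁺ {xs = S} (λ x∈ → T-not⁺ (T-not⁻ (allB⁻ {xs = S′} h (S⊆S′ x∈)) ∘ Reach-⊆ A⊆A′))

  noCycleThrough-≐ : ∀ {A A′ S S′} → A ⊆ A′ → A′ ⊆ A → S ⊆ S′ → S′ ⊆ S → noCycleThrough A S ≡ noCycleThrough A′ S′
  noCycleThrough-≐ A⊆A′ A′⊆A S⊆S′ S′⊆S = T-⇔⇒≡ (noCycleThrough-⊆ A′⊆A S′⊆S) (noCycleThrough-⊆ A⊆A′ S⊆S′)

  both-swap : ∀ {x a b} → x ∈ both (a , b) → (proj₂ x , proj₁ x) ∈ both (a , b)
  both-swap (here refl)         = there (here refl)
  both-swap (there (here refl)) = here refl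

  bothL-symmetric : ∀ X → Symmetric {bothL X}
  bothL-symmetric X m = let e , e∈ , x∈ = ∈-concatMap⁻-∃ both X m in ∈-concatMap⁺-∃ both e∈ (both-swap x∈)

  module _ (κ : Colouring) where

    compatible-monotone : ∀ e o → T (compatible κ e o) → ∀ {x} → x ∈ arcsOf G o e → κ (proj₁ x) ≼ κ (proj₂ x)
    compatible-monotone (a , b) o h x∈ with compare (κ a) (κ b)
    compatible-monotone (a , b) ⟶ h (here refl)         | tri< a<b _ _ = inj₁ a<b
    compatible-monotone (a , b) ⟵ h (here refl)         | tri> _ _ b<a = inj₁ b<a
    compatible-monotone (a , b) ⟶ h (here refl)         | tri≈ _ a≡b _ = inj₂ a≡b
    compatible-monotone (a , b) ⟵ h (here refl)         | tri≈ _ a≡b _ = inj₂ (sym a≡b)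
    compatible-monotone (a , b) ⟷ h (here refl)         | tri≈ _ a≡b _ = inj₂ a≡b
    compatible-monotone (a , b) ⟷ h (there (here refl)) | tri≈ _ a≡b _ = inj₂ (sym a≡b)

    compatible-single : ∀ e o → T (compatible κ e o) → ∀ {x} → x ∈ singleArcsOf G o e →
      κ (proj₁ x) < κ (proj₂ x) ⊎ (κ (proj₁ x) ≡ κ (proj₂ x) × T (negative κ (proj₁ x)))
    compatible-single (a , b) o h x∈ with compare (κ a) (κ b) | sgn f (κ a) in sgn≡
    compatible-single (a , b) ⟶ h (here refl) | tri< a<b _ _ | _     = inj₁ a<b
    compatible-single (a , b) ⟵ h (here refl) | tri> _ _ b<a | _     = inj₁ b<a
    compatible-single (a , b) ⟶ h (here refl) | tri≈ _ a≡b _ | false = inj₂ (a≡b , subst (T ∘ not) (sym sgn≡) tt)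
    compatible-single (a , b) ⟵ h (here refl) | tri≈ _ a≡b _ | false =
      inj₂ (sym a≡b , subst (T ∘ not) (sym (trans (cong (sgn f) (sym a≡b)) sgn≡)) tt)

    compatible-bidirected : ∀ e o → T (isBi o) → T (compatible κ e o) → κ (proj₁ e) ≡ κ (proj₂ e)
    compatible-bidirected (a , b) ⟷ _ h with compare (κ a) (κ b)
    ... | tri≈ _ a≡b _ = a≡b

    negativeArcs⊆bothL : ∀ X → negativeArcs κ X ⊆ bothL X
    negativeArcs⊆bothL X m with ∈-concatMap⁻-∃ (negativeBoth κ) X m
    ... | e , e∈ , x∈ with negative κ (proj₁ e) ∧ negative κ (proj₂ e)
    ...   | true = ∈-concatMap⁺-∃ both e∈ x∈

    negativeArcs-symmetric : ∀ X → Symmetric {negativeArcs κ X}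
    negativeArcs-symmetric X m with ∈-concatMap⁻-∃ (negativeBoth κ) X m
    ... | e , e∈ , x∈ with negative κ (proj₁ e) ∧ negative κ (proj₂ e) in neg≡
    ...   | true = ∈-concatMap⁺-∃ (negativeBoth κ) e∈
                     (subst (λ b → _ ∈ (if b then both e else [])) (sym neg≡) (both-swap x∈))

    negativeArcs-negative : ∀ X {x} → x ∈ negativeArcs κ X → T (negative κ (proj₁ x)) × T (negative κ (proj₂ x))
    negativeArcs-negative X m with ∈-concatMap⁻-∃ (negativeBoth κ) X m
    ... | (a , b) , _ , x∈ with T? (negative κ a) | T? (negative κ b)
    ...   | yes na | yes nb rewrite T⇒≡true na | T⇒≡true nb with x∈
    ...     | here refl         = na , nb
    ...     | there (here refl) = nb , na
    negativeArcs-negative X m | (a , b) , _ , x∈ | no ¬na | _ rewrite ¬T⇒≡false ¬na with x∈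
    ... | ()
    negativeArcs-negative X m | (a , b) , _ , x∈ | yes na | no ¬nb rewrite T⇒≡true na | ¬T⇒≡false ¬nb with x∈
    ... | ()

    module Monochromatic (X : List Arc) (mono : T (monochromatic κ X)) where

      bothL-constant : ∀ {x} → x ∈ bothL X → κ (proj₁ x) ≡ κ (proj₂ x)
      bothL-constant m with ∈-concatMap⁻-∃ both X m
      ... | e , e∈ , here refl         = toWitness (allB⁻ {xs = X} mono e∈)
      ... | e , e∈ , there (here refl) = sym (toWitness (allB⁻ {xs = X} mono e∈))

      walk-constant : ∀ {u v} → Walk (bothL X) u v → κ u ≡ κ v
      walk-constant = walk-preserves (λ u v → κ u ≡ κ v) refl trans bothL-constant

      negative-arc : ∀ {a b} → (a , b) ∈ bothL X → T (negative κ a) → T (negative κ b) × (a , b) ∈ negativeArcs κ X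
      negative-arc {a} {b} m na with ∈-concatMap⁻-∃ both X m
      ... | e , e∈ , x∈ = nb , ∈-concatMap⁺-∃ (negativeBoth κ) e∈ (inside (ends-negative x∈ na nb))
        where
        nb : T (negative κ b)
        nb = subst (T ∘ negativeColour) (bothL-constant m) na
        ends-negative : ∀ {e x} → x ∈ both e → T (negative κ (proj₁ x)) → T (negative κ (proj₂ x)) →
                        T (negative κ (proj₁ e)) × T (negative κ (proj₂ e))
        ends-negative (here refl)         n₁ n₂ = n₁ , n₂
        ends-negative (there (here refl)) n₁ n₂ = n₂ , n₁
        inside : T (negative κ (proj₁ e)) × T (negative κ (proj₂ e)) → (a , b) ∈ negativeBoth κ e
        inside (n₁ , n₂) rewrite T⇒≡true n₁ | T⇒≡true n₂ = x∈

      negative-walk : ∀ {u v} → Walk (bothL X) u v → T (negative κ u) → Walk (negativeArcs κ X) u v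
      negative-walk w nu = proj₂ (walk-restrict (T ∘ negative κ) negative-arc w nu)

  module CompatibleOrientation (κ : Colouring) (P : List Arc) (eo : Oriented)
                    (P-mono : T (monochromatic κ P)) (eo-compatible : T (compatibleᴼ κ eo)) where

    A₀ : List Arc
    A₀ = bothL P ++ arcsᴼ eo

    S₀ : List Arc
    S₀ = singleArcsᴼ eo

    E₀ : List Arc
    E₀ = P ++ bidirectedᴼ eo

    B₀ : List Arc
    B₀ = bothL E₀

    N₀ : List Arc
    N₀ = negativeArcs κ E₀

    Acyclic₀ : Set
    Acyclic₀ = T (noCycleThrough A₀ S₀)

    compatible-∈ : ∀ {e o} → (e , o) ∈ eo → T (compatible κ e o)
    compatible-∈ = allB⁻ {xs = eo} eo-compatible

    bidirectedᴼ-∈ : ∀ {e} → e ∈ bidirectedᴼ eo → (e , ⟷) ∈ eo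
    bidirectedᴼ-∈ m with ∈-concatMap⁻-∃ bidirectedOfᴼ eo m
    ... | (_ , ⟷) , eo∈ , here refl = eo∈

    E₀-mono : T (monochromatic κ E₀)
    E₀-mono = allB⁺ {xs = E₀} λ m → fromWitness (equal-ends m)
      where
      equal-ends : ∀ {e} → e ∈ E₀ → κ (proj₁ e) ≡ κ (proj₂ e)
      equal-ends m with MP.∈-++⁻ P m
      ... | inj₁ e∈P = toWitness (allB⁻ {xs = P} P-mono e∈P)
      ... | inj₂ e∈bi = compatible-bidirected κ _ ⟷ tt (compatible-∈ (bidirectedᴼ-∈ e∈bi))

    open Monochromatic κ E₀ E₀-mono public

    A₀-monotone : ∀ {x} → x ∈ A₀ → κ (proj₁ x) ≼ κ (proj₂ x)
    A₀-monotone m with MP.∈-++⁻ (bothL P) m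
    ... | inj₁ m∈P = let _ , e∈ , x∈ = ∈-concatMap⁻-∃ both P m∈P in inj₂ (bothL-constant (∈-concatMap⁺-∃ both (MP.∈-++⁺ˡ e∈) x∈))
    ... | inj₂ m∈eo with ∈-concatMap⁻-∃ arcsOfᴼ eo m∈eo
    ...   | (e , o) , eo∈ , x∈ = compatible-monotone κ e o (compatible-∈ eo∈) x∈

    A₀-walk-monotone : ∀ {u v} → Walk A₀ u v → κ u ≼ κ v
    A₀-walk-monotone = walk-preserves (λ u v → κ u ≼ κ v) ≼-refl ≼-trans A₀-monotone

    S₀⊆A₀ : S₀ ⊆ A₀
    S₀⊆A₀ m with ∈-concatMap⁻-∃ singleArcsOfᴼ eo m
    ... | (e , ⟶) , eo∈ , x∈ = MP.∈-++⁺ʳ (bothL P) (∈-concatMap⁺-∃ arcsOfᴼ eo∈ x∈)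
    ... | (e , ⟵) , eo∈ , x∈ = MP.∈-++⁺ʳ (bothL P) (∈-concatMap⁺-∃ arcsOfᴼ eo∈ x∈)

    S₀-increasing : ∀ {x} → x ∈ S₀ → κ (proj₁ x) < κ (proj₂ x) ⊎ (κ (proj₁ x) ≡ κ (proj₂ x) × T (negative κ (proj₁ x)))
    S₀-increasing m with ∈-concatMap⁻-∃ singleArcsOfᴼ eo m
    ... | (e , o) , eo∈ , x∈ = compatible-single κ e o (compatible-∈ eo∈) x∈

    B₀⊆A₀ : B₀ ⊆ A₀
    B₀⊆A₀ m with ∈-concatMap⁻-∃ both E₀ m
    ... | e , e∈ , x∈ with MP.∈-++⁻ P e∈
    ...   | inj₁ e∈P  = MP.∈-++⁺ˡ (∈-concatMap⁺-∃ both e∈P x∈)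
    ...   | inj₂ e∈bi = MP.∈-++⁺ʳ (bothL P) (∈-concatMap⁺-∃ arcsOfᴼ (bidirectedᴼ-∈ e∈bi) x∈)

    A₀⊆B₀∪S₀ : ∀ {x} → x ∈ A₀ → x ∈ B₀ ⊎ x ∈ S₀
    A₀⊆B₀∪S₀ m with MP.∈-++⁻ (bothL P) m
    ... | inj₁ m∈P = let e , e∈ , x∈ = ∈-concatMap⁻-∃ both P m∈P in inj₁ (∈-concatMap⁺-∃ both (MP.∈-++⁺ˡ e∈) x∈)
    ... | inj₂ m∈eo with ∈-concatMap⁻-∃ arcsOfᴼ eo m∈eo
    ...   | (e , ⟶) , eo∈ , x∈ = inj₂ (∈-concatMap⁺-∃ singleArcsOfᴼ eo∈ x∈)
    ...   | (e , ⟵) , eo∈ , x∈ = inj₂ (∈-concatMap⁺-∃ singleArcsOfᴼ eo∈ x∈)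
    ...   | (e , ⟷) , eo∈ , x∈ = inj₁ (∈-concatMap⁺-∃ both (MP.∈-++⁺ʳ P
                                   (∈-concatMap⁺-∃ bidirectedOfᴼ eo∈ (here refl))) x∈)

    no-return : Acyclic₀ → ∀ {s} → s ∈ S₀ → ¬ Walk A₀ (proj₂ s) (proj₁ s)
    no-return ac s∈ w = T-not⁻ (allB⁻ {xs = S₀} ac s∈) (Walk⇒Reach w)

    closed-walk-bidirected : Acyclic₀ → ∀ {u v} → Walk A₀ u v → Walk A₀ v u → Walk B₀ u v
    closed-walk-bidirected ac nil     back = nil
    closed-walk-bidirected ac (w ▷ m) back with A₀⊆B₀∪S₀ m
    ... | inj₁ m∈B₀ = closed-walk-bidirected ac w (arc m ++ᵂ back) ▷ m∈B₀
    ... | inj₂ m∈S₀ = ⊥-elim (no-return ac m∈S₀ (back ++ᵂ w))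

    bidirected-or-single : ∀ {u v} → Walk A₀ u v →
      Walk B₀ u v ⊎ (∃ λ s → s ∈ S₀ × Walk A₀ u (proj₁ s) × Walk A₀ (proj₂ s) v)
    bidirected-or-single nil = inj₁ nil
    bidirected-or-single (w ▷ m) with bidirected-or-single w
    ... | inj₂ (s , s∈ , w₁ , w₂) = inj₂ (s , s∈ , w₁ , w₂ ▷ m)
    ... | inj₁ w₀ with A₀⊆B₀∪S₀ m
    ...   | inj₁ m∈B₀ = inj₁ (w₀ ▷ m∈B₀)
    ...   | inj₂ m∈S₀ = inj₂ (_ , m∈S₀ , map-Walk B₀⊆A₀ w₀ , nil)

    add-single : ∀ x → ¬ Walk A₀ (proj₂ x) (proj₁ x) → Acyclic₀ →
                 T (noCycleThrough (bothL P ++ (x ∷ arcsᴼ eo)) (x ∷ S₀))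
    add-single x x-no-return ac = allB⁺ {xs = x ∷ S₀} (λ {s} s∈ → T-not⁺ (λ r → cycle s∈ (map-Walk to-front (Reach⇒Walk r))))
      where
      to-front : bothL P ++ (x ∷ arcsᴼ eo) ⊆ (x ∷ []) ++ A₀
      to-front m with MP.∈-++⁻ (bothL P) m
      ... | inj₁ m∈P              = there (MP.∈-++⁺ˡ m∈P)
      ... | inj₂ (here refl)      = here refl
      ... | inj₂ (there m∈eo)     = there (MP.∈-++⁺ʳ (bothL P) m∈eo)
      cycle : ∀ {s} → s ∈ x ∷ S₀ → ¬ Walk ((x ∷ []) ++ A₀) (proj₂ s) (proj₁ s)
      cycle (here refl) w with split-first (x ∷ []) w
      ... | inj₁ w₀                     = x-no-return w₀
      ... | inj₂ (_ , here refl , w₀ , _) = x-no-return w₀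
      cycle (there s∈) w with split-first (x ∷ []) w
      ... | inj₁ w₀ = no-return ac s∈ w₀
      ... | inj₂ (_ , here refl , w₁ , rest) with split-last (x ∷ []) rest
      ...   | inj₁ w₂                     = x-no-return (w₂ ++ᵂ (arc (S₀⊆A₀ s∈) ++ᵂ w₁))
      ...   | inj₂ (_ , here refl , _ , w₃) = x-no-return (w₃ ++ᵂ (arc (S₀⊆A₀ s∈) ++ᵂ w₁))

    No-cycle-via : Fin nV → Fin nV → Set
    No-cycle-via a b = ∀ {s} → s ∈ S₀ → ∀ {p₁ p₂} → p₁ ∈ a ∷ b ∷ [] → p₂ ∈ a ∷ b ∷ [] →
                       Walk A₀ (proj₂ s) p₁ → Walk A₀ p₂ (proj₁ s) → ⊥

    add-both : ∀ a b → Acyclic₀ → No-cycle-via a b → T (noCycleThrough (both (a , b) ++ A₀) S₀)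
    add-both a b ac no-via = allB⁺ {xs = S₀} (λ s∈ → T-not⁺ (λ r → cycle s∈ (Reach⇒Walk r)))
      where
      cycle : ∀ {s} → s ∈ S₀ → ¬ Walk (both (a , b) ++ A₀) (proj₂ s) (proj₁ s)
      cycle s∈ w with split-first (both (a , b)) w
      ... | inj₁ w₀ = no-return ac s∈ w₀
      ... | inj₂ (x , x∈ , w₁ , rest) with split-last (both (a , b)) rest
      ...   | inj₁ w₂                    = no-via s∈ (proj₁ (both-endpoints x∈)) (proj₂ (both-endpoints x∈)) w₁ w₂
      ...   | inj₂ (x′ , x′∈ , _ , w₃) = no-via s∈ (proj₁ (both-endpoints x∈)) (proj₂ (both-endpoints x′∈)) w₁ w₃

  module _ (κ : Colouring) where

    negativeComponents-≐ : ∀ {X Y} → X ⊆ Y → Y ⊆ X → negativeComponents κ X ≡ negativeComponents κ Y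
    negativeComponents-≐ X⊆Y Y⊆X = Components.components-≐ nV (negative κ)
      (Subset.concatMap⁺ (negativeBoth κ) X⊆Y) (Subset.concatMap⁺ (negativeBoth κ) Y⊆X)

    negativeComponents-↭ : ∀ {X Y} → X ↭ Y → negativeComponents κ X ≡ negativeComponents κ Y
    negativeComponents-↭ X↭Y = negativeComponents-≐ (Subset.⊆-reflexive-↭ X↭Y) (Subset.⊆-reflexive-↭ (↭-sym X↭Y))

    negativeComponents-positive : ∀ a b X → ¬ T (negative κ a) → negativeComponents κ ((a , b) ∷ X) ≡ negativeComponents κ X
    negativeComponents-positive a b X ¬na rewrite ¬T⇒≡false ¬na = refl

    negativeComponents-connected : ∀ a b X → T (negative κ a) → T (negative κ b) → Reach (negativeArcs κ X) a b →
                                   negativeComponents κ ((a , b) ∷ X) ≡ negativeComponents κ X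
    negativeComponents-connected a b X na nb r rewrite T⇒≡true na | T⇒≡true nb =
      Components.components-connected nV (negative κ) (negativeArcs κ X) (negativeArcs-symmetric κ X) (negativeArcs-negative κ X) a b r

    negativeComponents-join : ∀ a b X → T (negative κ a) → T (negative κ b) → ¬ Reach (negativeArcs κ X) a b →
                              negativeComponents κ X ≡ suc (negativeComponents κ ((a , b) ∷ X))
    negativeComponents-join a b X na nb a⇝̸b rewrite T⇒≡true na | T⇒≡true nb =
      Components.components-join nV (negative κ) (negativeArcs κ X) (negativeArcs-symmetric κ X) (negativeArcs-negative κ X) a b na nb a⇝̸b

    compatible-< : ∀ a b → κ a < κ b →
      T (compatible κ (a , b) ⟶) × ¬ T (compatible κ (a , b) ⟵) × ¬ T (compatible κ (a , b) ⟷)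
    compatible-< a b a<b with compare (κ a) (κ b)
    ... | tri< _ _ _   = tt , (λ ()) , (λ ())
    ... | tri≈ _ a≡b _ = ⊥-elim (irrefl a≡b a<b)
    ... | tri> _ _ b<a = ⊥-elim (irrefl refl (<-trans a<b b<a))

    compatible-> : ∀ a b → κ b < κ a →
      ¬ T (compatible κ (a , b) ⟶) × T (compatible κ (a , b) ⟵) × ¬ T (compatible κ (a , b) ⟷)
    compatible-> a b b<a with compare (κ a) (κ b)
    ... | tri< a<b _ _ = ⊥-elim (irrefl refl (<-trans a<b b<a))
    ... | tri≈ _ a≡b _ = ⊥-elim (irrefl (sym a≡b) b<a)
    ... | tri> _ _ _   = (λ ()) , tt , (λ ())

    compatible-≡⁺ : ∀ a b → κ a ≡ κ b → T (sgn f (κ a)) →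
      ¬ T (compatible κ (a , b) ⟶) × ¬ T (compatible κ (a , b) ⟵) × T (compatible κ (a , b) ⟷)
    compatible-≡⁺ a b a≡b pos with compare (κ a) (κ b)
    ... | tri< a<b _ _ = ⊥-elim (irrefl a≡b a<b)
    ... | tri> _ _ b<a = ⊥-elim (irrefl (sym a≡b) b<a)
    ... | tri≈ _ _ _ rewrite T⇒≡true pos = (λ ()) , (λ ()) , tt

    compatible-≡⁻ : ∀ a b → κ a ≡ κ b → ¬ T (sgn f (κ a)) →
      T (compatible κ (a , b) ⟶) × T (compatible κ (a , b) ⟵) × T (compatible κ (a , b) ⟷)
    compatible-≡⁻ a b a≡b ¬pos with compare (κ a) (κ b)
    ... | tri< a<b _ _ = ⊥-elim (irrefl a≡b a<b)
    ... | tri> _ _ b<a = ⊥-elim (irrefl (sym a≡b) b<a)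
    ... | tri≈ _ _ _ rewrite ¬T⇒≡false ¬pos = tt , tt , tt

  -- Deletion–contraction

  module DeletionContraction (κ : Colouring) (P : List Arc) (a b : Fin nV) (eo : Oriented)
                             (P-mono : T (monochromatic κ P)) (eo-compatible : T (compatibleᴼ κ eo)) where
    open CompatibleOrientation κ P eo P-mono eo-compatible

    e : Arc
    e = (a , b)

    acyclic₀ : Bool
    acyclic₀ = noCycleThrough A₀ S₀

    acyclicBoth : Bool
    acyclicBoth = noCycleThrough (both e ++ A₀) S₀

    valid₀ : Bool
    valid₀ = orientationValid κ P eo

    valid : Ori → Bool
    valid o = orientationValid κ P ((e , o) ∷ eo)

    validᶜ : Bool
    validᶜ = orientationValid κ (e ∷ P) eo

    powBi : Carrier
    powBi = pow R (1# + t) (#bidirected eo)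

    value₀ : Carrier
    value₀ = orientationWeight κ P eo

    signᶜ : Carrier
    signᶜ = pow R -1# (negativeComponents κ (e ∷ E₀))

    valueᶜ : Carrier
    valueᶜ = powBi * signᶜ

    valid₀≡acyclic₀ : valid₀ ≡ acyclic₀
    valid₀≡acyclic₀ = T-⇔⇒≡ (λ x → proj₁ (T-∧⁻ (proj₂ (T-∧⁻ {monochromatic κ P} x))))
                            (λ x → T-∧⁺ P-mono (T-∧⁺ x eo-compatible))

    valid⁺ : ∀ o → T (compatible κ e o) → T (acyclicᴼ P ((e , o) ∷ eo)) → T (valid o)
    valid⁺ o c x = T-∧⁺ P-mono (T-∧⁺ x (T-∧⁺ c eo-compatible))

    valid⁻ : ∀ o → T (valid o) → T (acyclicᴼ P ((e , o) ∷ eo)) × T (compatible κ e o)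
    valid⁻ o x = let x₁ , x₂ = T-∧⁻ {acyclicᴼ P ((e , o) ∷ eo)} (proj₂ (T-∧⁻ {monochromatic κ P} x)) in
                 x₁ , proj₁ (T-∧⁻ x₂)

    valid-incompatible : ∀ o → ¬ T (compatible κ e o) → valid o ≡ false
    valid-incompatible o ¬c = ¬T⇒≡false (¬c ∘ proj₂ ∘ valid⁻ o)

    validᶜ⁺ : κ a ≡ κ b → T (acyclicᴼ (e ∷ P) eo) → T validᶜ
    validᶜ⁺ a≡b x = T-∧⁺ (T-∧⁺ {⌊ κ a ≟C κ b ⌋} (fromWitness a≡b) P-mono) (T-∧⁺ x eo-compatible)

    validᶜ⁻ : T validᶜ → T (acyclicᴼ (e ∷ P) eo)
    validᶜ⁻ x = proj₁ (T-∧⁻ (proj₂ (T-∧⁻ {⌊ κ a ≟C κ b ⌋ ∧ monochromatic κ P} x)))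

    validᶜ-distinct : κ a ≢ κ b → validᶜ ≡ false
    validᶜ-distinct a≢b = ¬T⇒≡false (λ x →
      a≢b (toWitness (proj₁ (T-∧⁻ {⌊ κ a ≟C κ b ⌋} (proj₁ (T-∧⁻ {⌊ κ a ≟C κ b ⌋ ∧ monochromatic κ P} x))))))

    acyclic-⟷ : acyclicᴼ P ((e , ⟷) ∷ eo) ≡ acyclicBoth
    acyclic-⟷ = noCycleThrough-≐ {S = S₀} {S′ = S₀} (Subset.⊆-reflexive-↭ shuffle) (Subset.⊆-reflexive-↭ (↭-sym shuffle)) id id
      where
      shuffle : bothL P ++ (both e ++ arcsᴼ eo) ↭ both e ++ A₀
      shuffle = PermProps.shifts (bothL P) (both e)

    acyclic-contracted : acyclicᴼ (e ∷ P) eo ≡ acyclicBoth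
    acyclic-contracted = cong (λ A → noCycleThrough A S₀) (LP.++-assoc (both e) (bothL P) (arcsᴼ eo))

    acyclicBoth⇒acyclic₀ : T acyclicBoth → T acyclic₀
    acyclicBoth⇒acyclic₀ = noCycleThrough-⊆ {S = S₀} {S′ = S₀} (MP.∈-++⁺ʳ (both e)) id

    acyclic-single : ∀ x → ¬ Walk A₀ (proj₂ x) (proj₁ x) → noCycleThrough (bothL P ++ (x ∷ arcsᴼ eo)) (x ∷ S₀) ≡ acyclic₀
    acyclic-single x x-no-return = T-⇔⇒≡ (noCycleThrough-⊆ {S = S₀} {S′ = x ∷ S₀} A₀⊆ there) (add-single x x-no-return)
      where
      A₀⊆ : A₀ ⊆ bothL P ++ (x ∷ arcsᴼ eo)
      A₀⊆ = Subset.++⁺ʳ (bothL P) (Subset.xs⊆x∷xs _ x)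

    acyclicBoth≡acyclic₀ : (T acyclic₀ → No-cycle-via a b) → acyclicBoth ≡ acyclic₀
    acyclicBoth≡acyclic₀ no-via = T-⇔⇒≡ acyclicBoth⇒acyclic₀ (λ ac → add-both a b ac (no-via ac))

    valid⟷≡validᶜ : κ a ≡ κ b → T (compatible κ e ⟷) → valid ⟷ ≡ validᶜ
    valid⟷≡validᶜ a≡b c = T-⇔⇒≡
      (λ x → validᶜ⁺ a≡b (subst T (sym acyclic-contracted) (subst T acyclic-⟷ (proj₁ (valid⁻ ⟷ x)))))
      (λ x → valid⁺ ⟷ c (subst T (sym acyclic-⟷) (subst T acyclic-contracted (validᶜ⁻ x))))

    validᶜ≡valid₀ : κ a ≡ κ b → (T acyclic₀ → No-cycle-via a b) → validᶜ ≡ valid₀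
    validᶜ≡valid₀ a≡b no-via = T-⇔⇒≡
      (λ x → subst T (sym valid₀≡acyclic₀) (subst T (acyclicBoth≡acyclic₀ no-via) (subst T acyclic-contracted (validᶜ⁻ x))))
      (λ x → validᶜ⁺ a≡b (subst T (sym acyclic-contracted) (subst T (sym (acyclicBoth≡acyclic₀ no-via)) (subst T valid₀≡acyclic₀ x))))

    Σ-orientations : Carrier
    Σ-orientations = Σ[ allOri ] (λ o → orientationTerm κ P ((e , o) ∷ eo))

    deleted+contracted : Carrier
    deleted+contracted = orientationTerm κ P eo + t * orientationTerm κ (e ∷ P) eo

    x+0+0+0 : ∀ x → x + (0# + (0# + 0#)) ≈ x + t * 0#
    x+0+0+0 x = solve 2 (λ x t → x :+ (con 0 :+ (con 0 :+ con 0)) := x :+ t :* con 0) ≈-refl x t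

    0+x+0+0 : ∀ x → 0# + (x + (0# + 0#)) ≈ x + t * 0#
    0+x+0+0 x = solve 2 (λ x t → con 0 :+ (x :+ (con 0 :+ con 0)) := x :+ t :* con 0) ≈-refl x t

    no-descent : ∀ {u v} → κ u < κ v → ¬ Walk A₀ v u
    no-descent u<v w = <⇒⋡ u<v (A₀-walk-monotone w)

    single-valid : ∀ o x → arcsOf G o e ≡ x ∷ [] → singleArcsOf G o e ≡ x ∷ [] → T (compatible κ e o) →
                   ¬ Walk A₀ (proj₂ x) (proj₁ x) → valid o ≡ acyclic₀
    single-valid o x arcs≡ singles≡ c x-no-return = T-⇔⇒≡
      (λ v → subst T (acyclic-single x x-no-return) (subst T (acyclic≡ o x arcs≡ singles≡) (proj₁ (valid⁻ o v))))
      (λ ac → valid⁺ o c (subst T (sym (acyclic≡ o x arcs≡ singles≡)) (subst T (sym (acyclic-single x x-no-return)) ac)))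
      where
      acyclic≡ : ∀ o x → arcsOf G o e ≡ x ∷ [] → singleArcsOf G o e ≡ x ∷ [] →
                 acyclicᴼ P ((e , o) ∷ eo) ≡ noCycleThrough (bothL P ++ (x ∷ arcsᴼ eo)) (x ∷ S₀)
      acyclic≡ o x arcs≡ singles≡ rewrite arcs≡ | singles≡ = refl

    case-< : κ a < κ b → Σ-orientations ≈ deleted+contracted
    case-< a<b with compatible-< κ a b a<b
    ... | c⟶ , c⟵ , c⟷ = begin
      Σ-orientations
        ≈⟨ +-cong (⟦⟧-≡ value₀ (trans (single-valid ⟶ e refl refl c⟶ (no-descent a<b)) (sym valid₀≡acyclic₀)))
                  (+-cong (⟦⟧-≡ value₀ (valid-incompatible ⟵ c⟵)) (+-cong (⟦⟧-≡ _ (valid-incompatible ⟷ c⟷)) ≈-refl)) ⟩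
      ⟦ valid₀ ⟧ value₀ + (0# + (0# + 0#))
        ≈⟨ x+0+0+0 _ ⟩
      ⟦ valid₀ ⟧ value₀ + t * 0#
        ≈⟨ +-cong ≈-refl (*-cong ≈-refl (⟦⟧-≡ valueᶜ (sym (validᶜ-distinct (λ a≡b → irrefl a≡b a<b))))) ⟩
      deleted+contracted ∎

    case-> : κ b < κ a → Σ-orientations ≈ deleted+contracted
    case-> b<a with compatible-> κ a b b<a
    ... | c⟶ , c⟵ , c⟷ = begin
      Σ-orientations
        ≈⟨ +-cong (⟦⟧-≡ value₀ (valid-incompatible ⟶ c⟶))
                  (+-cong (⟦⟧-≡ value₀ (trans (single-valid ⟵ (b , a) refl refl c⟵ (no-descent b<a)) (sym valid₀≡acyclic₀)))
                          (+-cong (⟦⟧-≡ _ (valid-incompatible ⟷ c⟷)) ≈-refl)) ⟩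
      0# + (⟦ valid₀ ⟧ value₀ + (0# + 0#))
        ≈⟨ 0+x+0+0 _ ⟩
      ⟦ valid₀ ⟧ value₀ + t * 0#
        ≈⟨ +-cong ≈-refl (*-cong ≈-refl (⟦⟧-≡ valueᶜ (sym (validᶜ-distinct (λ a≡b → irrefl (sym a≡b) b<a))))) ⟩
      deleted+contracted ∎

    Identity : Set _
    Identity = ⟦ valid ⟶ ⟧ value₀ + (⟦ valid ⟵ ⟧ value₀ + ⟦ validᶜ ⟧ valueᶜ) ≈ ⟦ valid₀ ⟧ value₀

    equal-colours : κ a ≡ κ b → T (compatible κ e ⟷) → Identity → Σ-orientations ≈ deleted+contracted
    equal-colours a≡b c⟷ identity = begin
      Σ-orientations
        ≈⟨ +-cong ≈-refl (+-cong ≈-refl (+-cong (⟦⟧-cong (valid ⟷) (*-cong ≈-refl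
             (reflexive (cong (pow R -1#) (negativeComponents-↭ κ (PermProps.shift e P (bidirectedᴼ eo))))))) ≈-refl)) ⟩
      ⟦ valid ⟶ ⟧ value₀ + (⟦ valid ⟵ ⟧ value₀ + (⟦ valid ⟷ ⟧ (((1# + t) * powBi) * signᶜ) + 0#))
        ≈⟨ +-cong ≈-refl (+-cong ≈-refl (+-cong (⟦⟧-≡ _ (valid⟷≡validᶜ a≡b c⟷)) ≈-refl)) ⟩
      ⟦ valid ⟶ ⟧ value₀ + (⟦ valid ⟵ ⟧ value₀ + (⟦ validᶜ ⟧ (((1# + t) * powBi) * signᶜ) + 0#))
        ≈⟨ split-1+t (⟦ valid ⟶ ⟧ value₀) (⟦ valid ⟵ ⟧ value₀) validᶜ ⟩
      (⟦ valid ⟶ ⟧ value₀ + (⟦ valid ⟵ ⟧ value₀ + ⟦ validᶜ ⟧ valueᶜ)) + t * ⟦ validᶜ ⟧ valueᶜ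
        ≈⟨ +-cong identity ≈-refl ⟩
      deleted+contracted ∎
      where
      split-1+t : ∀ u v β → u + (v + (⟦ β ⟧ (((1# + t) * powBi) * signᶜ) + 0#)) ≈ (u + (v + ⟦ β ⟧ valueᶜ)) + t * ⟦ β ⟧ valueᶜ
      split-1+t u v true  = solve 5 (λ u v p s t → u :+ (v :+ (((con 1 :+ t) :* p) :* s :+ con 0)) := (u :+ (v :+ p :* s)) :+ t :* (p :* s))
                              ≈-refl u v powBi signᶜ t
      split-1+t u v false = solve 3 (λ u v t → u :+ (v :+ (con 0 :+ con 0)) := (u :+ (v :+ con 0)) :+ t :* con 0) ≈-refl u v t

    collapse : ∀ {β₁ β₂} → β₁ ≡ false → β₂ ≡ false → validᶜ ≡ valid₀ → valueᶜ ≡ value₀ →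
               ⟦ β₁ ⟧ value₀ + (⟦ β₂ ⟧ value₀ + ⟦ validᶜ ⟧ valueᶜ) ≈ ⟦ valid₀ ⟧ value₀
    collapse refl refl valid≡ value≡ =
      ≈-trans (+-identityˡ _) (≈-trans (+-identityˡ _) (≈-trans (⟦⟧-≡ valueᶜ valid≡) (⟦⟧-cong valid₀ (reflexive value≡))))

    case-positive : κ a ≡ κ b → T (sgn f (κ a)) → Σ-orientations ≈ deleted+contracted
    case-positive a≡b pos with compatible-≡⁺ κ a b a≡b pos
    ... | ¬c⟶ , ¬c⟵ , c⟷ = equal-colours a≡b c⟷
      (collapse (valid-incompatible ⟶ ¬c⟶) (valid-incompatible ⟵ ¬c⟵)
                (validᶜ≡valid₀ a≡b (λ _ → no-via))
                (cong (λ k → powBi * pow R -1# k) (negativeComponents-positive κ a b E₀ (λ neg → T-not⁻ neg pos))))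
      where
      κ-end : ∀ {p} → p ∈ a ∷ b ∷ [] → κ p ≡ κ a
      κ-end (here refl)         = refl
      κ-end (there (here refl)) = sym a≡b
      -- a cycle through a single arc s and the new edge would force κ a between the ends of s
      no-via : No-cycle-via a b
      no-via {s} s∈ p₁∈ p₂∈ w₁ w₂ =
        S.[ (λ s₁<s₂ → <⇒⋡ s₁<s₂ (≼-trans s₂≼a a≼s₁))
          , (λ (s₁≡s₂ , neg) → T-not⁻ (subst (T ∘ negativeColour)
                                          (sym (≼-antisym a≼s₁ (subst (_≼ κ a) (sym s₁≡s₂) s₂≼a))) neg) pos)
          ] (S₀-increasing s∈)
        where
        s₂≼a : κ (proj₂ s) ≼ κ a
        s₂≼a = subst (κ (proj₂ s) ≼_) (κ-end p₁∈) (A₀-walk-monotone w₁)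
        a≼s₁ : κ a ≼ κ (proj₁ s)
        a≼s₁ = subst (_≼ κ (proj₁ s)) (κ-end p₂∈) (A₀-walk-monotone w₂)

    module NegativeEqual (a≡b : κ a ≡ κ b) (¬pos : ¬ T (sgn f (κ a))) where

      c⟶ : T (compatible κ e ⟶)
      c⟶ = proj₁ (compatible-≡⁻ κ a b a≡b ¬pos)

      c⟵ : T (compatible κ e ⟵)
      c⟵ = proj₁ (proj₂ (compatible-≡⁻ κ a b a≡b ¬pos))

      c⟷ : T (compatible κ e ⟷)
      c⟷ = proj₂ (proj₂ (compatible-≡⁻ κ a b a≡b ¬pos))

      na : T (negative κ a)
      na = T-not⁺ ¬pos

      nb : T (negative κ b)
      nb = subst (T ∘ negativeColour) a≡b na

      N₀⊆A₀ : N₀ ⊆ A₀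
      N₀⊆A₀ = B₀⊆A₀ ∘ negativeArcs⊆bothL κ E₀

      single-invalid : ∀ o x → arcsOf G o e ≡ x ∷ [] → Walk A₀ (proj₂ x) (proj₁ x) → valid o ≡ false
      single-invalid o x arcs≡ w = ¬T⇒≡false (λ v → T-not⁻ (allB⁻ {xs = singleArcsOf G o e ++ S₀} (proj₁ (valid⁻ o v)) (x∈ o arcs≡))
                                                       (Reach-⊆ (Subset.++⁺ʳ (bothL P) (MP.∈-++⁺ʳ (arcsOf G o e))) (Walk⇒Reach w)))
        where
        x∈ : ∀ o → arcsOf G o e ≡ x ∷ [] → x ∈ singleArcsOf G o e ++ S₀
        x∈ ⟶ refl = here refl
        x∈ ⟵ refl = here refl

      link : ∀ {p₁ p₂} → p₁ ∈ a ∷ b ∷ [] → p₂ ∈ a ∷ b ∷ [] → Walk (both e ++ A₀) p₁ p₂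
      link (here refl)         (here refl)         = nil
      link (here refl)         (there (here refl)) = arc (here refl)
      link (there (here refl)) (here refl)         = arc (there (here refl))
      link (there (here refl)) (there (here refl)) = nil

      contracted-cycle : ∀ {s} → s ∈ S₀ → ∀ {p₁ p₂} → p₁ ∈ a ∷ b ∷ [] → p₂ ∈ a ∷ b ∷ [] →
                         Walk A₀ (proj₂ s) p₁ → Walk A₀ p₂ (proj₁ s) → validᶜ ≡ false
      contracted-cycle s∈ p₁∈ p₂∈ w₁ w₂ = ¬T⇒≡false (λ v →
        T-not⁻ (allB⁻ {xs = S₀} (subst T acyclic-contracted (validᶜ⁻ v)) s∈)
               (Walk⇒Reach (map-Walk (MP.∈-++⁺ʳ (both e)) w₁ ++ᵂ (link p₁∈ p₂∈ ++ᵂ map-Walk (MP.∈-++⁺ʳ (both e)) w₂))))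

      connected : Reach N₀ a b → Identity
      connected r = collapse (single-invalid ⟶ (a , b) refl b⇝a) (single-invalid ⟵ (b , a) refl a⇝b)
                             (validᶜ≡valid₀ a≡b no-via)
                             (cong (λ k → powBi * pow R -1# k) (negativeComponents-connected κ a b E₀ na nb r))
        where
        a⇝b : Walk A₀ a b
        a⇝b = map-Walk N₀⊆A₀ (Reach⇒Walk r)
        b⇝a : Walk A₀ b a
        b⇝a = map-Walk N₀⊆A₀ (Reach⇒Walk (Reach-sym (negativeArcs-symmetric κ E₀) r))
        path : ∀ {p₁ p₂} → p₁ ∈ a ∷ b ∷ [] → p₂ ∈ a ∷ b ∷ [] → Walk A₀ p₁ p₂
        path (here refl)         (here refl)         = nil
        path (here refl)         (there (here refl)) = a⇝b
        path (there (here refl)) (here refl)         = b⇝a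
        path (there (here refl)) (there (here refl)) = nil
        no-via : T acyclic₀ → No-cycle-via a b
        no-via ac s∈ p₁∈ p₂∈ w₁ w₂ = no-return ac s∈ (w₁ ++ᵂ (path p₁∈ p₂∈ ++ᵂ w₂))

      cyclic : ¬ T acyclic₀ → Identity
      cyclic ¬ac = ≈-trans (+-cong (⟦false⟧ value₀ (¬ac ∘ valid⇒acyclic₀ ⟶))
                           (+-cong (⟦false⟧ value₀ (¬ac ∘ valid⇒acyclic₀ ⟵))
                                   (⟦false⟧ valueᶜ (¬ac ∘ acyclicBoth⇒acyclic₀ ∘ subst T acyclic-contracted ∘ validᶜ⁻))))
                   (≈-trans (≈-trans (+-identityˡ _) (+-identityˡ _)) (≈-sym (⟦false⟧ value₀ (¬ac ∘ subst T valid₀≡acyclic₀))))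
        where
        valid⇒acyclic₀ : ∀ o → T (valid o) → T acyclic₀
        valid⇒acyclic₀ o = noCycleThrough-⊆ {S = S₀} {S′ = singleArcsOf G o e ++ S₀}
                             (Subset.++⁺ʳ (bothL P) (Subset.xs⊆ys++xs _ (arcsOf G o e))) (MP.∈-++⁺ʳ _) ∘ proj₁ ∘ valid⁻ o

      module Separated (a⇝̸b : ¬ Reach N₀ a b) (ac : T acyclic₀) where

        valid₀≡true : valid₀ ≡ true
        valid₀≡true = trans valid₀≡acyclic₀ (T⇒≡true ac)

        -- a walk between a and b must leave the bidirected part, as it is not a negative path
        through-single : ∀ {u v} → u ∈ a ∷ b ∷ [] → Walk A₀ u v → ¬ Reach N₀ u v →
                         ∃ λ s → s ∈ S₀ × Walk A₀ u (proj₁ s) × Walk A₀ (proj₂ s) v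
        through-single u∈ w u⇝̸v with bidirected-or-single w
        ... | inj₂ found = found
        ... | inj₁ w₀ = ⊥-elim (u⇝̸v (Walk⇒Reach (negative-walk w₀ (negative-end u∈))))
          where
          negative-end : ∀ {u} → u ∈ a ∷ b ∷ [] → T (negative κ u)
          negative-end (here refl)         = na
          negative-end (there (here refl)) = nb

        only-a⇝b : Walk A₀ a b → ¬ Walk A₀ b a → Identity
        only-a⇝b a⇝b b⇝̸a with through-single (here refl) a⇝b a⇝̸b
        ... | s , s∈ , w₁ , w₂ =
          ≈-trans (+-cong (⟦⟧-≡ value₀ (trans (single-valid ⟶ e refl refl c⟶ b⇝̸a) (T⇒≡true ac)))
                          (+-cong (⟦⟧-≡ value₀ (single-invalid ⟵ (b , a) refl a⇝b))
                                  (⟦⟧-≡ valueᶜ (contracted-cycle s∈ (there (here refl)) (here refl) w₂ w₁))))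
          (≈-trans (≈-trans (+-cong ≈-refl (+-identityˡ _)) (+-identityʳ _)) (⟦⟧-≡ value₀ (sym valid₀≡true)))

        only-b⇝a : Walk A₀ b a → ¬ Walk A₀ a b → Identity
        only-b⇝a b⇝a a⇝̸b′ with through-single (there (here refl)) b⇝a (a⇝̸b ∘ Reach-sym (negativeArcs-symmetric κ E₀))
        ... | s , s∈ , w₁ , w₂ =
          ≈-trans (+-cong (⟦⟧-≡ value₀ (single-invalid ⟶ (a , b) refl b⇝a))
                          (+-cong (⟦⟧-≡ value₀ (trans (single-valid ⟵ (b , a) refl refl c⟵ a⇝̸b′) (T⇒≡true ac)))
                                  (⟦⟧-≡ valueᶜ (contracted-cycle s∈ (here refl) (there (here refl)) w₂ w₁))))
          (≈-trans (≈-trans (+-identityˡ _) (+-identityʳ _)) (⟦⟧-≡ value₀ (sym valid₀≡true)))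

        -- the new edge joins two negative components, so the sign flips
        unrelated : ¬ Walk A₀ a b → ¬ Walk A₀ b a → Identity
        unrelated a⇝̸b′ b⇝̸a =
          ≈-trans (+-cong (⟦⟧-≡ value₀ (trans (single-valid ⟶ e refl refl c⟶ b⇝̸a) (T⇒≡true ac)))
                          (+-cong (⟦⟧-≡ value₀ (trans (single-valid ⟵ (b , a) refl refl c⟵ a⇝̸b′) (T⇒≡true ac)))
                                  (⟦⟧-≡ valueᶜ (trans (validᶜ≡valid₀ a≡b (λ _ → no-via)) valid₀≡true))))
          (≈-trans (+-cong value₀≈ (+-cong value₀≈ ≈-refl))
          (≈-trans (cancel powBi signᶜ) (≈-sym (≈-trans (⟦⟧-≡ value₀ valid₀≡true) value₀≈))))
          where
          value₀≈ : value₀ ≈ powBi * (-1# * signᶜ)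
          value₀≈ = reflexive (cong (λ k → powBi * pow R -1# k) (negativeComponents-join κ a b E₀ na nb a⇝̸b))
          cancel : ∀ p s → p * (-1# * s) + (p * (-1# * s) + p * s) ≈ p * (-1# * s)
          cancel p s = begin
            p * (-1# * s) + (p * (-1# * s) + p * s)
              ≈⟨ solve 3 (λ p s m → p :* (m :* s) :+ (p :* (m :* s) :+ p :* s) := p :* (m :* s) :+ (p :* s :+ m :* (p :* s))) ≈-refl p s -1# ⟩
            p * (-1# * s) + (p * s + -1# * (p * s))
              ≈⟨ +-cong ≈-refl (x+-1*x (p * s)) ⟩
            p * (-1# * s) + 0#
              ≈⟨ +-identityʳ _ ⟩
            p * (-1# * s) ∎
          no-via : No-cycle-via a b
          no-via s∈ (here refl)         (here refl)         w₁ w₂ = no-return ac s∈ (w₁ ++ᵂ w₂)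
          no-via s∈ (there (here refl)) (there (here refl)) w₁ w₂ = no-return ac s∈ (w₁ ++ᵂ w₂)
          no-via s∈ (here refl)         (there (here refl)) w₁ w₂ = b⇝̸a (w₂ ++ᵂ (arc (S₀⊆A₀ s∈) ++ᵂ w₁))
          no-via s∈ (there (here refl)) (here refl)         w₁ w₂ = a⇝̸b′ (w₂ ++ᵂ (arc (S₀⊆A₀ s∈) ++ᵂ w₁))

        identity : Identity
        identity with T? (reach A₀ nV a b) | T? (reach A₀ nV b a)
        ... | yes a⇝b | yes b⇝a =
          ⊥-elim (a⇝̸b (Walk⇒Reach (negative-walk (closed-walk-bidirected ac (Reach⇒Walk a⇝b) (Reach⇒Walk b⇝a)) na)))
        ... | yes a⇝b | no  b⇝̸a = only-a⇝b (Reach⇒Walk a⇝b) (b⇝̸a ∘ Walk⇒Reach)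
        ... | no  a⇝̸b′ | yes b⇝a = only-b⇝a (Reach⇒Walk b⇝a) (a⇝̸b′ ∘ Walk⇒Reach)
        ... | no  a⇝̸b′ | no  b⇝̸a = unrelated (a⇝̸b′ ∘ Walk⇒Reach) (b⇝̸a ∘ Walk⇒Reach)

      identity : Identity
      identity with T? (reach N₀ nV a b) | T? acyclic₀
      ... | yes r   | _      = connected r
      ... | no  a⇝̸b | no ¬ac = cyclic ¬ac
      ... | no  a⇝̸b | yes ac = Separated.identity a⇝̸b ac

    case-negative : κ a ≡ κ b → ¬ T (sgn f (κ a)) → Σ-orientations ≈ deleted+contracted
    case-negative a≡b ¬pos = equal-colours a≡b (NegativeEqual.c⟷ a≡b ¬pos) (NegativeEqual.identity a≡b ¬pos)

    deletion-contraction : Σ-orientations ≈ deleted+contracted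
    deletion-contraction = by-order (compare (κ a) (κ b))
      where
      by-order : Tri (κ a < κ b) (κ a ≡ κ b) (κ b < κ a) → Σ-orientations ≈ deleted+contracted
      by-order (tri< a<b _ _) = case-< a<b
      by-order (tri> _ _ b<a) = case-> b<a
      by-order (tri≈ _ a≡b _) with T? (sgn f (κ a))
      ... | yes pos = case-positive a≡b pos
      ... | no ¬pos = case-negative a≡b ¬pos

  module _ (κ : Colouring) where

    module _ (P : List Arc) (a b : Fin nV) (eo : Oriented) where

      vanishing : (∀ o → ¬ T (orientationValid κ P (((a , b) , o) ∷ eo))) → ¬ T (orientationValid κ P eo) →
                  ¬ T (orientationValid κ ((a , b) ∷ P) eo) →
                  Σ[ allOri ] (λ o → orientationTerm κ P (((a , b) , o) ∷ eo)) ≈ orientationTerm κ P eo + t * orientationTerm κ ((a , b) ∷ P) eo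
      vanishing ¬valid ¬valid₀ ¬validᶜ =
        ≈-trans (Σ-0 allOri _ (λ o → ⟦false⟧ (orientationWeight κ P (((a , b) , o) ∷ eo)) (¬valid o)))
                (≈-sym (≈-trans (+-cong (⟦false⟧ _ ¬valid₀) (*-cong ≈-refl (⟦false⟧ _ ¬validᶜ)))
                                (≈-trans (+-identityˡ _) (zeroʳ t))))

      deletion-contraction :
        Σ[ allOri ] (λ o → orientationTerm κ P (((a , b) , o) ∷ eo)) ≈ orientationTerm κ P eo + t * orientationTerm κ ((a , b) ∷ P) eo
      deletion-contraction with T? (monochromatic κ P) | T? (compatibleᴼ κ eo)
      ... | yes mono | yes compat = DeletionContraction.deletion-contraction κ P a b eo mono compat
      ... | no ¬mono | _ = vanishing
        (λ o → ¬mono ∘ proj₁ ∘ T-∧⁻ {monochromatic κ P})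
        (¬mono ∘ proj₁ ∘ T-∧⁻ {monochromatic κ P})
        (¬mono ∘ proj₂ ∘ T-∧⁻ {⌊ κ a ≟C κ b ⌋} ∘ proj₁ ∘ T-∧⁻ {⌊ κ a ≟C κ b ⌋ ∧ monochromatic κ P})
      ... | yes _    | no ¬compat = vanishing
        (λ o → ¬compat ∘ proj₂ ∘ T-∧⁻ {compatible κ (a , b) o} ∘ proj₂ ∘ T-∧⁻ {acyclicᴼ P (((a , b) , o) ∷ eo)}
                       ∘ proj₂ ∘ T-∧⁻ {monochromatic κ P})
        (¬compat ∘ proj₂ ∘ T-∧⁻ {acyclicᴼ P eo} ∘ proj₂ ∘ T-∧⁻ {monochromatic κ P})
        (¬compat ∘ proj₂ ∘ T-∧⁻ {acyclicᴼ ((a , b) ∷ P) eo} ∘ proj₂ ∘ T-∧⁻ {⌊ κ a ≟C κ b ⌋ ∧ monochromatic κ P})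

    orientationSum≈subsetSum : ∀ es P → orientationSum κ es P ≈ subsetSum κ es P
    orientationSum≈subsetSum [] P =
      ≈-trans (+-identityʳ _) (≈-trans (⟦⟧-≡ _ (BP.∧-identityʳ (monochromatic κ P)))
        (⟦⟧-cong (monochromatic κ P) (≈-trans (*-identityˡ _) (reflexive (cong (pow R -1# ∘ negativeComponents κ) (LP.++-identityʳ P))))))
    orientationSum≈subsetSum ((a , b) ∷ es) P = begin
      Σ[ concatMap (λ o → map (((a , b) , o) ∷_) (assignments allOri es)) allOri ] (orientationTerm κ P)
        ≈⟨ Σ-concatMap (λ o → map (((a , b) , o) ∷_) (assignments allOri es)) allOri (orientationTerm κ P) ⟩
      Σ[ allOri ] (λ o → Σ[ map (((a , b) , o) ∷_) (assignments allOri es) ] (orientationTerm κ P))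
        ≈⟨ Σ-cong allOri (λ o → reflexive (Σ-map (((a , b) , o) ∷_) (assignments allOri es) (orientationTerm κ P))) ⟩
      Σ[ allOri ] (λ o → Σ[ assignments allOri es ] (λ eo → orientationTerm κ P (((a , b) , o) ∷ eo)))
        ≈⟨ Σ-swap allOri (assignments allOri es) (λ o eo → orientationTerm κ P (((a , b) , o) ∷ eo)) ⟩
      Σ[ assignments allOri es ] (λ eo → Σ[ allOri ] (λ o → orientationTerm κ P (((a , b) , o) ∷ eo)))
        ≈⟨ Σ-cong (assignments allOri es) (deletion-contraction P a b) ⟩
      Σ[ assignments allOri es ] (λ eo → orientationTerm κ P eo + t * orientationTerm κ ((a , b) ∷ P) eo)
        ≈⟨ Σ-+ (assignments allOri es) _ _ ⟩
      orientationSum κ es P + Σ[ assignments allOri es ] (λ eo → t * orientationTerm κ ((a , b) ∷ P) eo)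
        ≈⟨ +-cong ≈-refl (≈-sym (*-Σ (assignments allOri es) t _)) ⟩
      orientationSum κ es P + t * orientationSum κ es ((a , b) ∷ P)
        ≈⟨ +-cong (orientationSum≈subsetSum es P) (*-cong ≈-refl (orientationSum≈subsetSum es ((a , b) ∷ P))) ⟩
      subsetSum κ ((a , b) ∷ es) P ∎

  -- The two expansions

  monomial : Colouring → Carrier
  monomial κ = Π[ allFin nV ] (λ v → pow R (val R qv xv f (κ v)) (w v))

  edges : List Arc
  edges = tabulate ends

  orientedEdges : Biorientation G → Oriented
  orientedEdges γ = tabulate (λ i → (ends i , γ i))

  module _ (γ : Biorientation G) (κ : Colouring) where

    validᴳ : Bool
    validᴳ = acyclic G γ ∧ allB (λ i → compatible κ (ends i) (γ i)) (allFin nE)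

    negativeComponentsᴳ : ℕ
    negativeComponentsᴳ = components (negative κ)
      (concatMap (λ i → if isBi (γ i) ∧ negative κ (proj₁ (ends i)) ∧ negative κ (proj₂ (ends i)) then arcsOf G ⟷ (ends i) else [])
                 (allFin nE))

    weightᴳ : Carrier
    weightᴳ = pow R (1# + t) (numBi G γ) * pow R -1# negativeComponentsᴳ

  mutual
    RHS-unfold : RHS R G w N f _<_ compare t qv xv ≈
                 Σ[ allBiorientations G ] (λ γ → Σ[ funs colours nV ] (λ κ → ⟦ validᴳ γ κ ⟧ (weightᴳ γ κ * monomial κ)))
    RHS-unfold = Σ-cong (allBiorientations G) (λ γ → Σ-cong (funs colours nV) (λ κ →
      ⟦⟧-≡ _ (cong (acyclic G γ ∧_) (allB-cong (allFin nE) (λ i _ → compatible-agrees κ γ i)))))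

    -- the left-hand side is the compatibility test local to RHS in Defs, which has no name outside it
    compatible-agrees : ∀ κ (γ : Biorientation G) i → _ ≡ compatible κ (ends i) (γ i)
    compatible-agrees κ γ i with compare (κ (proj₁ (ends i))) (κ (proj₂ (ends i))) | γ i
    ... | tri< _ _ _ | ⟶ = refl
    ... | tri< _ _ _ | ⟵ = refl
    ... | tri< _ _ _ | ⟷ = refl
    ... | tri> _ _ _ | ⟶ = refl
    ... | tri> _ _ _ | ⟵ = refl
    ... | tri> _ _ _ | ⟷ = refl
    ... | tri≈ _ _ _ | _ = refl

  negativeArcs-bidirectedᴼ : ∀ κ (eo : Oriented) →
    concatMap (λ ((a , b) , o) → if isBi o ∧ negative κ a ∧ negative κ b then both (a , b) else []) eo ≡ negativeArcs κ (bidirectedᴼ eo)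
  negativeArcs-bidirectedᴼ κ []             = refl
  negativeArcs-bidirectedᴼ κ ((_ , ⟶) ∷ eo) = negativeArcs-bidirectedᴼ κ eo
  negativeArcs-bidirectedᴼ κ ((_ , ⟵) ∷ eo) = negativeArcs-bidirectedᴼ κ eo
  negativeArcs-bidirectedᴼ κ ((e , ⟷) ∷ eo) = cong (negativeBoth κ e ++_) (negativeArcs-bidirectedᴼ κ eo)

  orientedEdges-term : ∀ κ γ → ⟦ validᴳ γ κ ⟧ (weightᴳ γ κ) ≈ orientationTerm κ [] (orientedEdges γ)
  orientedEdges-term κ γ = ≈-trans (⟦⟧-≡ _ valid≡)
    (⟦⟧-cong (acyclicᴼ [] (orientedEdges γ) ∧ compatibleᴼ κ (orientedEdges γ))
             (*-cong (reflexive (cong (pow R (1# + t)) #bi≡)) (reflexive (cong (pow R -1#) components≡))))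
    where
    pair : Fin nE → Arc × Ori
    pair i = (ends i , γ i)
    valid≡ : validᴳ γ κ ≡ acyclicᴼ [] (orientedEdges γ) ∧ compatibleᴼ κ (orientedEdges γ)
    valid≡ = cong₂ _∧_
      (cong₂ noCycleThrough
        (concatMap-tabulate nE (λ i → arcsOf G (γ i) (ends i)) id arcsOfᴼ pair (λ _ → refl))
        (concatMap-tabulate nE (λ i → singleArcsOf G (γ i) (ends i)) id singleArcsOfᴼ pair (λ _ → refl)))
      (allB-tabulate nE (λ i → compatible κ (ends i) (γ i)) id (λ (e , o) → compatible κ e o) pair (λ _ → refl))
    #bi≡ : numBi G γ ≡ #bidirected (orientedEdges γ)
    #bi≡ = countB-tabulate nE (isBi ∘ γ) id (isBi ∘ proj₂) pair (λ _ → refl)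
    components≡ : negativeComponentsᴳ γ κ ≡ negativeComponents κ ([] ++ bidirectedᴼ (orientedEdges γ))
    components≡ = cong (components (negative κ))
      (trans (concatMap-tabulate nE _ id (λ ((a , b) , o) → if isBi o ∧ negative κ a ∧ negative κ b then both (a , b) else []) pair (λ _ → refl))
             (negativeArcs-bidirectedᴼ κ (orientedEdges γ)))

  RHS-expansion : RHS R G w N f _<_ compare t qv xv ≈ Σ[ funs colours nV ] (λ κ → orientationSum κ edges [] * monomial κ)
  RHS-expansion = begin
    RHS R G w N f _<_ compare t qv xv
      ≈⟨ RHS-unfold ⟩
    Σ[ allBiorientations G ] (λ γ → Σ[ funs colours nV ] (λ κ → ⟦ validᴳ γ κ ⟧ (weightᴳ γ κ * monomial κ)))
      ≈⟨ Σ-swap (allBiorientations G) (funs colours nV) _ ⟩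
    Σ[ funs colours nV ] (λ κ → Σ[ allBiorientations G ] (λ γ → ⟦ validᴳ γ κ ⟧ (weightᴳ γ κ * monomial κ)))
      ≈⟨ Σ-cong (funs colours nV) (λ κ → ≈-trans (Σ-cong (allBiorientations G) (λ γ → ≈-sym (⟦⟧-* (validᴳ γ κ) (weightᴳ γ κ) (monomial κ))))
                                                  (≈-sym (Σ-* (allBiorientations G) (monomial κ) _))) ⟩
    Σ[ funs colours nV ] (λ κ → Σ[ allBiorientations G ] (λ γ → ⟦ validᴳ γ κ ⟧ (weightᴳ γ κ)) * monomial κ)
      ≈⟨ Σ-cong (funs colours nV) (λ κ → *-cong (≈-trans (Σ-cong (allBiorientations G) (orientedEdges-term κ))
                                                          (FunctionSums.Σ-funs-assignments R allOri nE ends (orientationTerm κ []))) ≈-refl) ⟩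
    Σ[ funs colours nV ] (λ κ → orientationSum κ edges [] * monomial κ) ∎

  open Factorisation R _≟C_ colours (enumVar-unique N f) (enumVar-complete N f)
    using (constant; constant⁻; constant⁺; leader; leader⁻; leader⁺; class; Π-classes; Σ-constant; factorise; Π-δ-filterᵇ)
  open PowerSums R N qv xv using (sgnR; pPleth-expansion)

  sign-↭ : ∀ κ {X Y} → X ↭ Y → sign κ X ≡ sign κ Y
  sign-↭ κ {X} {Y} X↭Y = cong₂ (λ b k → ⟦ b ⟧ (pow R -1# k))
    (T-⇔⇒≡ (allB-⊆ {xs = Y} {ys = X} (Subset.⊆-reflexive-↭ (↭-sym X↭Y))) (allB-⊆ {xs = X} {ys = Y} (Subset.⊆-reflexive-↭ X↭Y)))
    (negativeComponents-↭ κ X↭Y)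

  module SpanningSubgraph (X : List Arc) where

    _~_ : Fin nV → Fin nV → Bool
    u ~ v = reach (bothL X) nV u v

    ~-isEquivalence : IsEquivalence (λ u v → T (u ~ v))
    ~-isEquivalence = record { refl = Reach-refl _ ; sym = Reach-sym (bothL-symmetric X) ; trans = Reach-trans }

    constant≡monochromatic : ∀ κ → constant _~_ κ ≡ monochromatic κ X
    constant≡monochromatic κ = T-⇔⇒≡
      (λ h → allB⁺ {xs = X} (λ {e} e∈ → fromWitness (constant⁻ _~_ κ h (proj₁ e) (proj₂ e)
                                                       (Walk⇒Reach (arc (∈-concatMap⁺-∃ both e∈ (here refl)))))))
      (λ h → constant⁺ _~_ κ (λ u v r → Monochromatic.walk-constant κ X h (Reach⇒Walk r)))

    -- each class of ~ contributes the sign of its colour once, at its leader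
    leader-signs : ∀ κ → T (monochromatic κ X) →
      Π[ allFin nV ] (λ v → if leader _~_ v then sgnR f (κ v) else 1#) ≈ pow R -1# (negativeComponents κ X)
    leader-signs κ mono = begin
      Π[ allFin nV ] (λ v → if leader _~_ v then sgnR f (κ v) else 1#)
        ≈⟨ Π-cong-∈ (allFin nV) (λ v _ → sign-at v) ⟩
      Π[ allFin nV ] (λ v → if leader _~_ v ∧ negative κ v then -1# else 1#)
        ≈⟨ Π-sign (λ v → leader _~_ v ∧ negative κ v) (allFin nV) ⟩
      pow R -1# (countB (λ v → leader _~_ v ∧ negative κ v) (allFin nV))
        ≡⟨ cong (pow R -1#) (countB-cong (allFin nV) (λ v _ → negative-leader v)) ⟩
      pow R -1# (negativeComponents κ X) ∎
      where
      open Components nV (negative κ) using (isLeader; isLeader⁻; isLeader⁺)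
      open Monochromatic κ X mono using (walk-constant; negative-walk)
      sign-at : ∀ v → (if leader _~_ v then sgnR f (κ v) else 1#) ≈ (if leader _~_ v ∧ negative κ v then -1# else 1#)
      sign-at v with leader _~_ v | sgn f (κ v)
      ... | true  | true  = ≈-refl
      ... | true  | false = ≈-refl
      ... | false | _     = ≈-refl
      negative-leader : ∀ v → (leader _~_ v ∧ negative κ v) ≡ isLeader (negativeArcs κ X) v
      negative-leader v = T-⇔⇒≡
        (λ h → let ℓv , nv = T-∧⁻ {leader _~_ v} h in
           isLeader⁺ nv (λ u _ u<v r → leader⁻ _~_ v ℓv u u<v (Reach-⊆ (negativeArcs⊆bothL κ X) r)))
        (λ h → let nv , below = isLeader⁻ h in
           T-∧⁺ {leader _~_ v} (leader⁺ _~_ v (λ u u<v r →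
             let w  = Reach⇒Walk r
                 nu = subst (T ∘ negativeColour) (sym (walk-constant w)) nv
             in below u nu u<v (Walk⇒Reach (negative-walk w nu)))) nv)

    weight : Fin nV → Colour → Carrier
    weight u z = (if leader _~_ u then sgnR f z else 1#) * pow R (val R qv xv f z) (w u)

    classWeight : Fin nV → ℕ
    classWeight v = foldr ℕ._+_ 0 (map w (class _~_ v))

    Π-class : ∀ v → T (leader _~_ v) → ∀ z → Π[ class _~_ v ] (λ u → weight u z) ≈ sgnR f z * pow R (val R qv xv f z) (classWeight v)
    Π-class v ℓv z = begin
      Π[ class _~_ v ] (λ u → weight u z)
        ≈⟨ Π-* (class _~_ v) _ _ ⟩
      Π[ class _~_ v ] (λ u → if leader _~_ u then sgnR f z else 1#) * Π[ class _~_ v ] (λ u → pow R (val R qv xv f z) (w u))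
        ≈⟨ *-cong (≈-trans (Π-cong-∈ (class _~_ v) (λ u u∈ → reflexive (cong (λ b → if b then sgnR f z else 1#)
                                 (leader-in-class u (proj₂ (MP.∈-filter⁻ (T? ∘ (v ~_)) {xs = allFin nV} u∈))))))
                           (≈-trans (Π-δ-filterᵇ (sgnR f z) v (v ~_))
                                    (reflexive (cong (λ b → if b then sgnR f z else 1#) (T⇒≡true (Reach-refl v))))))
                  (Π-pow (class _~_ v) (val R qv xv f z) w) ⟩
      sgnR f z * pow R (val R qv xv f z) (classWeight v) ∎
      where
      leader-in-class : ∀ u → T (v ~ u) → leader _~_ u ≡ ⌊ u ≟F v ⌋
      leader-in-class u v~u = T-⇔⇒≡ is-v (λ u≡v → subst (T ∘ leader _~_) (sym (toWitness u≡v)) ℓv)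
        where
        is-v : T (leader _~_ u) → T ⌊ u ≟F v ⌋
        is-v ℓu with ℕP.<-cmp (toℕ u) (toℕ v)
        ... | tri< u<v _ _ = ⊥-elim (leader⁻ _~_ v ℓv u u<v (Reach-sym (bothL-symmetric X) v~u))
        ... | tri≈ _ u≡v _ = fromWitness (FP.toℕ-injective u≡v)
        ... | tri> _ _ v<u = ⊥-elim (leader⁻ _~_ u ℓu v v<u v~u)

    components-expansion :
      Π[ filterᵇ (leader _~_) (allFin nV) ] (λ v → pPleth R qv xv (classWeight v) f) ≈ Σ[ funs colours nV ] (λ κ → sign κ X * monomial κ)
    components-expansion = begin
      Π[ filterᵇ (leader _~_) (allFin nV) ] (λ v → pPleth R qv xv (classWeight v) f)
        ≈⟨ Π-cong-∈ (filterᵇ (leader _~_) (allFin nV)) (λ v v∈ → ≈-trans (pPleth-expansion (classWeight v) f)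
             (Σ-cong colours (λ z → ≈-sym (Π-class v (proj₂ (MP.∈-filter⁻ (T? ∘ leader _~_) {xs = allFin nV} v∈)) z)))) ⟩
      Π-classes nV _~_ weight
        ≈⟨ ≈-sym (factorise nV _~_ ~-isEquivalence weight) ⟩
      Σ-constant nV _~_ weight
        ≈⟨ Σ-cong (funs colours nV) per-colouring ⟩
      Σ[ funs colours nV ] (λ κ → sign κ X * monomial κ) ∎
      where
      per-colouring : ∀ κ → ⟦ constant _~_ κ ⟧ (Π[ allFin nV ] (λ v → weight v (κ v))) ≈ sign κ X * monomial κ
      per-colouring κ = begin
        ⟦ constant _~_ κ ⟧ (Π[ allFin nV ] (λ v → weight v (κ v)))
          ≈⟨ ⟦⟧-cong (constant _~_ κ) (Π-* (allFin nV) _ _) ⟩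
        ⟦ constant _~_ κ ⟧ (Π[ allFin nV ] (λ v → if leader _~_ v then sgnR f (κ v) else 1#) * monomial κ)
          ≈⟨ ⟦⟧-≡ _ (constant≡monochromatic κ) ⟩
        ⟦ monochromatic κ X ⟧ (Π[ allFin nV ] (λ v → if leader _~_ v then sgnR f (κ v) else 1#) * monomial κ)
          ≈⟨ signs (T? (monochromatic κ X)) ⟩
        ⟦ monochromatic κ X ⟧ (pow R -1# (negativeComponents κ X) * monomial κ)
          ≈⟨ ≈-sym (⟦⟧-* (monochromatic κ X) _ (monomial κ)) ⟩
        sign κ X * monomial κ ∎
        where
        signs : Dec (T (monochromatic κ X)) →
          ⟦ monochromatic κ X ⟧ (Π[ allFin nV ] (λ v → if leader _~_ v then sgnR f (κ v) else 1#) * monomial κ) ≈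
          ⟦ monochromatic κ X ⟧ (pow R -1# (negativeComponents κ X) * monomial κ)
        signs (yes mono) = ⟦⟧-cong (monochromatic κ X) (*-cong (leader-signs κ mono) ≈-refl)
        signs (no ¬mono) rewrite ¬T⇒≡false ¬mono = ≈-refl

  components-expansion : ∀ A X → A ≡ bothL X →
    Π[ filterᵇ (leader (λ u v → reach A nV u v)) (allFin nV) ]
      (λ v → pPleth R qv xv (foldr ℕ._+_ 0 (map w (class (λ u v → reach A nV u v) v))) f)
      ≈ Σ[ funs colours nV ] (λ κ → sign κ X * monomial κ)
  components-expansion _ X refl = SpanningSubgraph.components-expansion X

  bools : List Bool
  bools = true ∷ false ∷ []

  selected : List (Arc × Bool) → List Arc
  selected = concatMap (λ (e , s) → if s then e ∷ [] else [])

  markedEdges : (Fin nE → Bool) → List (Arc × Bool)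
  markedEdges S = tabulate (λ i → (ends i , S i))

  arcsSub-selected : ∀ S → arcsSub G S ≡ bothL (selected (markedEdges S))
  arcsSub-selected S = trans
    (concatMap-tabulate nE (λ i → if S i then arcsOf G ⟷ (ends i) else []) id (λ (e , s) → if s then both e else [])
                        (λ i → (ends i , S i)) (λ _ → refl))
    (bothL-selected (markedEdges S))
    where
    bothL-selected : ∀ (L : List (Arc × Bool)) → concatMap (λ (e , s) → if s then both e else []) L ≡ bothL (selected L)
    bothL-selected []             = refl
    bothL-selected ((e , true) ∷ L)  = cong (both e ++_) (bothL-selected L)
    bothL-selected ((e , false) ∷ L) = bothL-selected L

  subsetSum-assignments : ∀ κ es P →
    Σ[ assignments bools es ] (λ x → pow R t (countB proj₂ x) * sign κ (selected x ++ P)) ≈ subsetSum κ es P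
  subsetSum-assignments κ []       P = ≈-trans (+-identityʳ _) (*-identityˡ _)
  subsetSum-assignments κ (e ∷ es) P = begin
    Σ[ assignments bools (e ∷ es) ] term
      ≈⟨ Σ-concatMap (λ s → map ((e , s) ∷_) xs) bools term ⟩
    Σ[ map ((e , true) ∷_) xs ] term + (Σ[ map ((e , false) ∷_) xs ] term + 0#)
      ≈⟨ +-cong (reflexive (Σ-map ((e , true) ∷_) xs term)) (+-cong (reflexive (Σ-map ((e , false) ∷_) xs term)) ≈-refl) ⟩
    Σ[ xs ] (λ x → t * pow R t (countB proj₂ x) * sign κ (e ∷ selected x ++ P)) + (Σ[ xs ] (λ x → term ((e , false) ∷ x)) + 0#)
      ≈⟨ +-cong (Σ-cong xs (λ x → ≈-trans (*-assoc _ _ _) (*-cong ≈-refl (*-cong ≈-refl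
           (reflexive (sign-↭ κ (↭-sym (PermProps.shift e (selected x) P)))))))) ≈-refl ⟩
    Σ[ xs ] (λ x → t * (pow R t (countB proj₂ x) * sign κ (selected x ++ e ∷ P))) + (Σ[ xs ] (λ x → term ((e , false) ∷ x)) + 0#)
      ≈⟨ +-cong (≈-sym (*-Σ xs t _)) ≈-refl ⟩
    t * Σ[ xs ] (λ x → pow R t (countB proj₂ x) * sign κ (selected x ++ e ∷ P)) + (Σ[ xs ] (λ x → term ((e , false) ∷ x)) + 0#)
      ≈⟨ +-cong (*-cong ≈-refl (subsetSum-assignments κ es (e ∷ P))) (+-cong (subsetSum-assignments κ es P) ≈-refl) ⟩
    t * subsetSum κ es (e ∷ P) + (subsetSum κ es P + 0#)
      ≈⟨ solve 3 (λ t a b → t :* a :+ (b :+ con 0) := b :+ t :* a) ≈-refl t _ _ ⟩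
    subsetSum κ (e ∷ es) P ∎
    where
    xs : List (List (Arc × Bool))
    xs = assignments bools es
    term : List (Arc × Bool) → Carrier
    term x = pow R t (countB proj₂ x) * sign κ (selected x ++ P)

  XB-expansion : XBpleth R G w N f t qv xv ≈ Σ[ funs colours nV ] (λ κ → subsetSum κ edges [] * monomial κ)
  XB-expansion = begin
    XBpleth R G w N f t qv xv
      ≈⟨ Σ-cong subsets (λ S → *-cong ≈-refl (components-expansion (arcsSub G S) (selected (markedEdges S)) (arcsSub-selected S))) ⟩
    Σ[ subsets ] (λ S → pow R t (#S S) * Σ[ funs colours nV ] (λ κ → sign κ (selected (markedEdges S)) * monomial κ))
      ≈⟨ Σ-cong subsets (λ S → *-Σ (funs colours nV) _ _) ⟩
    Σ[ subsets ] (λ S → Σ[ funs colours nV ] (λ κ → pow R t (#S S) * (sign κ (selected (markedEdges S)) * monomial κ)))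
      ≈⟨ Σ-swap subsets (funs colours nV) _ ⟩
    Σ[ funs colours nV ] (λ κ → Σ[ subsets ] (λ S → pow R t (#S S) * (sign κ (selected (markedEdges S)) * monomial κ)))
      ≈⟨ Σ-cong (funs colours nV) (λ κ → ≈-trans (Σ-cong subsets (λ S → ≈-sym (*-assoc _ _ _))) (≈-sym (Σ-* subsets (monomial κ) _))) ⟩
    Σ[ funs colours nV ] (λ κ → Σ[ subsets ] (λ S → pow R t (#S S) * sign κ (selected (markedEdges S))) * monomial κ)
      ≈⟨ Σ-cong (funs colours nV) (λ κ → *-cong (subsets-sum κ) ≈-refl) ⟩
    Σ[ funs colours nV ] (λ κ → subsetSum κ edges [] * monomial κ) ∎
    where
    subsets : List (Fin nE → Bool)
    subsets = allEdgeSubsets G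
    #S : (Fin nE → Bool) → ℕ
    #S S = countB S (allFin nE)
    subsets-sum : ∀ κ → Σ[ subsets ] (λ S → pow R t (#S S) * sign κ (selected (markedEdges S))) ≈ subsetSum κ edges []
    subsets-sum κ = begin
      Σ[ subsets ] (λ S → pow R t (#S S) * sign κ (selected (markedEdges S)))
        ≈⟨ Σ-cong subsets (λ S → *-cong (reflexive (cong (pow R t) (countB-tabulate nE S id proj₂ (λ i → (ends i , S i)) (λ _ → refl))))
                                         (reflexive (cong (sign κ) (sym (LP.++-identityʳ (selected (markedEdges S))))))) ⟩
      Σ[ subsets ] (λ S → pow R t (countB proj₂ (markedEdges S)) * sign κ (selected (markedEdges S) ++ []))
        ≈⟨ FunctionSums.Σ-funs-assignments R bools nE ends (λ x → pow R t (countB proj₂ x) * sign κ (selected x ++ [])) ⟩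
      Σ[ assignments bools edges ] (λ x → pow R t (countB proj₂ x) * sign κ (selected x ++ []))
        ≈⟨ subsetSum-assignments κ edges [] ⟩
      subsetSum κ edges [] ∎

theorem2 : ∀ {c ℓ ℓ' : Level} (R : CommutativeRing c ℓ)
    (G : Graph) (w : Fin (Graph.nV G) → ℕ) → (∀ v → 1 ≤ w v) →
    (f : Expr) (N : ℕ)
    (_<_ : Rel (Var N f) ℓ') (ord : IsStrictTotalOrder _≡_ _<_)
    (t : CommutativeRing.Carrier R) (qv : ℕ → CommutativeRing.Carrier R)
    (xv : Fin N → CommutativeRing.Carrier R) →
    CommutativeRing._≈_ R (XBpleth R G w N f t qv xv)
    (RHS R G w N f _<_ (IsStrictTotalOrder.compare ord) t qv xv)
theorem2 R G w _ f N _<_ ord t qv xv = begin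
  XBpleth R G w N f t qv xv
    ≈⟨ XB-expansion ⟩
  Σ[ funs colours nV ] (λ κ → subsetSum κ edges [] * monomial κ)
    ≈⟨ Σ-cong (funs colours nV) (λ κ → *-cong (≈-sym (orientationSum≈subsetSum κ edges [])) ≈-refl) ⟩
  Σ[ funs colours nV ] (λ κ → orientationSum κ edges [] * monomial κ)
    ≈⟨ ≈-sym RHS-expansion ⟩
  RHS R G w N f _<_ (IsStrictTotalOrder.compare ord) t qv xv ∎
  where
  open Expansions R G w f N _<_ ord t qv xv
  open Graph G using (nV)
  open CommutativeRing R using (_*_; *-cong)
  open RingSums R
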